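{- Let $a_n$ be the number of $\pi\in S_n$ avoiding both arrow patterns $(12;3\to 2)$ and $(1;1\to 1)$, with $a_0=1$ and $a_1=0$. For $n\ge 2$, \[a_n=\sum_{k=2}^{n}\binom{n-2}{k-2}(a_{k-1}+a_{k-2})=\sum_{k=0}^{n-1}\binom{n-1}{k}a_k.\]
   Context: Standard cycle form of $\sigma\in S_n$: product of disjoint cycles (fixed points included), each cycle starting with its largest element, cycles listed in increasing order of largest elements. The fundamental bijection $\theta:S_n\to S_n$ erases the parentheses of the standard cycle form to give a one-line permutation. For $\pi\in S_n$, $\hat\pi=\theta^{ -1}(\pi)$. An arrow pattern $(\nu;H)$ of size $k$: a string $\nu=a_1\dots a_m$ of positive integers and a set $H$ of arrows $b\to c$, with all integers appearing forming $[k]$. $\pi\in S_n$ contains $(\nu;H)$ if there is $X=\{x_1<\dots<x_k\}\subseteq[n]$ with positions $t_1<\dots<t_m$ such that $\pi_{t_1}\cdots\pi_{t_m}=x_{a_1}\cdots x_{a_m}$ and $\hat\pi(x_b)=x_c$ for every arrow $b\to c\in H$; otherwise it avoids it. In particular $\pi$ avoids $(1;1\to1)$ iff $\hat\pi$ has no fixed points. -}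

module Defs where

open import Data.Nat using (ℕ; zero; suc; _+_; _*_; _∸_; _<ᵇ_; _≡ᵇ_)
open import Data.Nat.Combinatorics using (_C_)
open import Data.Bool using (Bool; true; false; _∧_; not; if_then_else_)
open import Data.List using (List; []; _∷_; _++_; map; concatMap; length; filter; applyUpTo)
open import Data.Bool.ListAction using (any; all)
open import Data.Nat.ListAction using (sum)
open import Data.Maybe using (Maybe; just; nothing)
open import Data.Product using (_×_; _,_)
open import Relation.Nullary.Decidable using (yes; no)
open import Data.Bool.Properties using (T?)

-- Permutations of [n] = {1,…,n} in one-line notation are lists of naturals.

insertEverywhere : ℕ → List ℕ → List (List ℕ)
insertEverywhere x [] = (x ∷ []) ∷ []
insertEverywhere x (y ∷ ys) = (x ∷ y ∷ ys) ∷ map (y ∷_) (insertEverywhere x ys)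

S : ℕ → List (List ℕ)
S zero = [] ∷ []
S (suc n) = concatMap (insertEverywhere (suc n)) (S n)

-- θ⁻¹: split the one-line word before each left-to-right maximum;
-- the blocks are the cycles of the standard cycle form.
cycs : ℕ → List ℕ → List ℕ → List (List ℕ)
cycs m cur [] = cur ∷ []
cycs m cur (x ∷ xs) = if m <ᵇ x then cur ∷ cycs x (x ∷ []) xs
                                 else cycs m (cur ++ (x ∷ [])) xs

cycles : List ℕ → List (List ℕ)
cycles [] = []
cycles (x ∷ xs) = cycs x (x ∷ []) xs

succIn : ℕ → List ℕ → ℕ → Maybe ℕ
succIn f [] x = nothing
succIn f (y ∷ []) x = if x ≡ᵇ y then just f else nothing
succIn f (y ∷ z ∷ ys) x = if x ≡ᵇ y then just z else succIn f (z ∷ ys) x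

cycImage : List ℕ → ℕ → Maybe ℕ
cycImage [] x = nothing
cycImage (f ∷ c) x = succIn f (f ∷ c) x

imageIn : List (List ℕ) → ℕ → ℕ
imageIn [] x = x
imageIn (c ∷ cs) x with cycImage c x
... | just y = y
... | nothing = imageIn cs x

hat : List ℕ → ℕ → ℕ
hat π = imageIn (cycles π)

record ArrowPattern : Set where
  constructor pat
  field
    ν    : List ℕ
    H    : List (ℕ × ℕ)
    size : ℕ
open ArrowPattern public

subsetsFrom : ℕ → ℕ → ℕ → List (List ℕ)
subsetsFrom lo r zero = [] ∷ []
subsetsFrom lo zero (suc k) = []
subsetsFrom lo (suc r) (suc k) =
  map (lo ∷_) (subsetsFrom (suc lo) r k) ++ subsetsFrom (suc lo) r (suc k)

subsets : ℕ → ℕ → List (List ℕ)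
subsets n k = subsetsFrom 1 n k

subseqs : ℕ → List ℕ → List (List ℕ)
subseqs zero xs = [] ∷ []
subseqs (suc m) [] = []
subseqs (suc m) (x ∷ xs) = map (x ∷_) (subseqs m xs) ++ subseqs (suc m) xs

-- 1-based indexing: nth X i = x_i
nth : List ℕ → ℕ → ℕ
nth [] i = 0
nth (x ∷ xs) zero = 0
nth (x ∷ xs) (suc zero) = x
nth (x ∷ xs) (suc (suc i)) = nth xs (suc i)

listEq : List ℕ → List ℕ → Bool
listEq [] [] = true
listEq [] (_ ∷ _) = false
listEq (_ ∷ _) [] = false
listEq (x ∷ xs) (y ∷ ys) = (x ≡ᵇ y) ∧ listEq xs ys

-- π ∈ S_n contains (ν; H): some X ⊆ [n], |X| = k, and positions t₁<…<t_m with
-- π_{t₁}⋯π_{t_m} = x_{a₁}⋯x_{a_m} and hat π (x_b) = x_c for each b → c ∈ H.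
contains : List ℕ → ArrowPattern → Bool
contains π p =
  any (λ X → any (λ s → listEq s (map (nth X) (ν p))) (subseqs (length (ν p)) π)
             ∧ all (λ { (b , c) → hat π (nth X b) ≡ᵇ nth X c }) (H p))
      (subsets (length π) (size p))

avoids : List ℕ → ArrowPattern → Bool
avoids π p = not (contains π p)

p12-3→2 : ArrowPattern
p12-3→2 = pat (1 ∷ 2 ∷ []) ((3 , 2) ∷ []) 3

p1-1→1 : ArrowPattern
p1-1→1 = pat (1 ∷ []) ((1 , 1) ∷ []) 1

a : ℕ → ℕ
a n = length (filter (λ π → T? (avoids π p12-3→2 ∧ avoids π p1-1→1)) (S n))

sumFromTo : ℕ → ℕ → (ℕ → ℕ) → ℕ
sumFromTo lo hi f = sum (applyUpTo (λ i → f (lo + i)) (suc hi ∸ lo))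

{-# OPTIONS --safe #-}
-- θ⁻¹ cuts π before each left-to-right maximum, and π̂ maps each letter to the next one in its block
-- and the last letter of a block to the first. So π̂ has a fixed point iff some left-to-right maximum
-- is followed by a larger letter or ends π, and π contains (12; 3→2) iff some descent y z is preceded
-- by a letter smaller than z. Both conditions are decided by one left-to-right scan remembering the
-- maximum, the minimum and the last letter read, and whether that letter opened a block that is still
-- a singleton; call the words passing it admissible.
-- For n ≥ 2 write π = P 1 z. No letter after 1 can end a descent, and a left-to-right maximum inside z
-- would leave a singleton block at the end; so π is admissible iff z increases, n lies in P, and P
-- passes the scan except that its last block may be a singleton. With |z| = j there are C(n-2, j)
-- choices of z and, after standardising P to a permutation of [m+1] with m = n-2-j, a_{m+1} + a_m
-- choices of P: the a_m extra ones end with the singleton block {m+1}. Pascal's rule gives the second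
-- formula.
module Submission where

open import Defs
open import Data.Bool using (Bool; true; false; T; _∧_; not; if_then_else_)
open import Data.Bool.ListAction using (all)
open import Data.Bool.Properties using (T?; T-≡; T-∧; ∧-assoc; ∧-zeroʳ; ∧-identityʳ)
open import Data.Empty using (⊥; ⊥-elim)
open import Data.List
  using (List; []; _∷_; _++_; map; concat; concatMap; length; filter; head; applyUpTo; applyDownFrom)
open import Data.List.Properties
  using (∷-injective; ∷ʳ-injective; ++-assoc; ++-identityʳ; map-∘; map-cong-local; length-map; length-applyDownFrom)
open import Data.List.Membership.Propositional using (_∈_; _∉_; find; lose)
open import Data.List.Membership.Propositional.Properties
  using (∈-++⁺ˡ; ∈-++⁺ʳ; ∈-++⁻; ∈-insert; ∈-∃++; ∈-map⁺; ∈-map⁻; ∈-applyDownFrom⁺)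
open import Data.List.Relation.Binary.Permutation.Propositional
  using (_↭_; prep; swap; ↭-refl; ↭-sym; ↭-trans; ↭⇒↭ₛ)
import Data.List.Relation.Binary.Permutation.Propositional.Properties as ↭
open import Data.List.Relation.Binary.Permutation.Propositional.Properties using (All-resp-↭; ∈-resp-↭; ↭-length)
open import Data.List.Relation.Binary.Sublist.Propositional using (_⊆_; []; _∷_; _∷ʳ_; minimum; to∈; from∈)
import Data.List.Relation.Binary.Sublist.Propositional.Properties as Sublist
open import Data.List.Relation.Unary.All as All using (All; []; _∷_)
open import Data.List.Relation.Unary.All.Properties
  using (++⁺; ++⁻ˡ; ++⁻ʳ; concat⁺; map⁺; all⁺; all⁻; applyDownFrom⁺₁)
open import Data.List.Relation.Unary.AllPairs using ([]; _∷_)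
open import Data.List.Relation.Unary.Any using (here; there)
open import Data.List.Relation.Unary.Any.Properties using (any⁺; any⁻)
open import Data.List.Relation.Unary.Unique.Propositional using (Unique)
import Data.List.Relation.Unary.Unique.Propositional.Properties as Unique
open import Data.Maybe using (just; nothing)
open import Data.Maybe.Relation.Unary.All as Maybe using (just; nothing)
open import Data.Nat using (ℕ; zero; suc; _+_; _*_; _∸_; _≤_; _<_; _<ᵇ_; _≡ᵇ_; z≤n; s≤s; s≤s⁻¹)
open import Data.Nat.Combinatorics using (_C_; nCk+nC[k+1]≡[n+1]C[k+1]; k>n⇒nCk≡0)
open import Data.Nat.ListAction using (sum)
open import Data.Nat.ListAction.Properties using (sum-↭)
open import Data.Nat.Properties
open import Algebra.Properties.CommutativeSemigroup +-commutativeSemigroup using (interchange; x∙yz≈y∙xz)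
open import Data.Product using (_×_; _,_; ∃; ∃₂; proj₁; proj₂; map₁; uncurry)
open import Data.Sum using (_⊎_; inj₁; inj₂)
open import Data.Unit using (⊤; tt)
open import Function using (_∘_)
open import Function.Bundles using (Equivalence)
open import Relation.Nullary using (¬_; yes; no)
open import Relation.Nullary.Reflects using (Reflects; ofʸ; ofⁿ; fromEquivalence)
open import Relation.Binary.PropositionalEquality
  using (_≡_; _≢_; refl; sym; trans; cong; cong₂; subst; subst₂; setoid; module ≡-Reasoning)
open import Data.List.Relation.Binary.Permutation.Setoid.Properties (setoid ℕ) using (Unique-resp-↭)

open Equivalence using (to; from)

private
  variable
    A B : Set

∑ : (A → ℕ) → List A → ℕ
∑ f xs = sum (map f xs)

∑-++ : (f : A → ℕ) (xs ys : List A) → ∑ f (xs ++ ys) ≡ ∑ f xs + ∑ f ys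
∑-++ f [] ys = refl
∑-++ f (x ∷ xs) ys = trans (cong (f x +_) (∑-++ f xs ys)) (sym (+-assoc (f x) _ _))

∑-concatMap : (f : B → ℕ) (g : A → List B) (xs : List A) →
              ∑ f (concatMap g xs) ≡ ∑ (λ x → ∑ f (g x)) xs
∑-concatMap f g [] = refl
∑-concatMap f g (x ∷ xs) =
  trans (∑-++ f (g x) (concatMap g xs)) (cong (∑ f (g x) +_) (∑-concatMap f g xs))

∑-map : (f : B → ℕ) (g : A → B) (xs : List A) → ∑ f (map g xs) ≡ ∑ (f ∘ g) xs
∑-map f g [] = refl
∑-map f g (x ∷ xs) = cong (f (g x) +_) (∑-map f g xs)

∑-↭ : (f : A → ℕ) {xs ys : List A} → xs ↭ ys → ∑ f xs ≡ ∑ f ys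
∑-↭ f p = sum-↭ (↭.map⁺ f p)

∑-cong : {f g : A → ℕ} {xs : List A} → All (λ x → f x ≡ g x) xs → ∑ f xs ≡ ∑ g xs
∑-cong [] = refl
∑-cong (e ∷ es) = cong₂ _+_ e (∑-cong es)

∑-≡0 : {f : A → ℕ} {xs : List A} → All (λ x → f x ≡ 0) xs → ∑ f xs ≡ 0
∑-≡0 [] = refl
∑-≡0 (e ∷ es) = cong₂ _+_ e (∑-≡0 es)

∑-+ : (f g : A → ℕ) (xs : List A) → ∑ (λ x → f x + g x) xs ≡ ∑ f xs + ∑ g xs
∑-+ f g [] = refl
∑-+ f g (x ∷ xs) =
  trans (cong (f x + g x +_) (∑-+ f g xs)) (interchange (f x) (g x) (∑ f xs) (∑ g xs))

∑-*ˡ : (c : ℕ) (f : A → ℕ) (xs : List A) → ∑ (λ x → c * f x) xs ≡ c * ∑ f xs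
∑-*ˡ c f [] = sym (*-zeroʳ c)
∑-*ˡ c f (x ∷ xs) =
  trans (cong (c * f x +_) (∑-*ˡ c f xs)) (sym (*-distribˡ-+ c (f x) (∑ f xs)))

∑-*ʳ : (f : A → ℕ) (c : ℕ) (xs : List A) → ∑ (λ x → f x * c) xs ≡ ∑ f xs * c
∑-*ʳ f c [] = refl
∑-*ʳ f c (x ∷ xs) =
  trans (cong (f x * c +_) (∑-*ʳ f c xs)) (sym (*-distribʳ-+ c (f x) (∑ f xs)))

[_] : Bool → ℕ
[ true ] = 1
[ false ] = 0

¬T⇒≡false : ∀ {b} → ¬ T b → b ≡ false
¬T⇒≡false {true} ¬t = ⊥-elim (¬t tt)
¬T⇒≡false {false} _ = refl

¬T-not⇒T : ∀ b → ¬ T (not b) → T b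
¬T-not⇒T true _ = tt
¬T-not⇒T false ¬t = ¬t tt

[∧]≡* : ∀ a b → [ a ∧ b ] ≡ [ b ] * [ a ]
[∧]≡* true true = refl
[∧]≡* true false = refl
[∧]≡* false true = refl
[∧]≡* false false = refl

length-filter≡∑ : (p : A → Bool) (xs : List A) →
                  length (filter (T? ∘ p) xs) ≡ ∑ ([_] ∘ p) xs
length-filter≡∑ p [] = refl
length-filter≡∑ p (x ∷ xs) with p x
... | true = cong suc (length-filter≡∑ p xs)
... | false = length-filter≡∑ p xs

sumBelow : ℕ → (ℕ → ℕ) → ℕ
sumBelow k f = sum (applyUpTo f k)

sumBelow-cong : ∀ k {f g : ℕ → ℕ} → (∀ i → f i ≡ g i) → sumBelow k f ≡ sumBelow k g
sumBelow-cong zero e = refl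
sumBelow-cong (suc k) e = cong₂ _+_ (e 0) (sumBelow-cong k (e ∘ suc))

sumBelow-+ : ∀ k (f g : ℕ → ℕ) → sumBelow k (λ i → f i + g i) ≡ sumBelow k f + sumBelow k g
sumBelow-+ zero f g = refl
sumBelow-+ (suc k) f g =
  trans (cong (f 0 + g 0 +_) (sumBelow-+ k (f ∘ suc) (g ∘ suc)))
        (interchange (f 0) (g 0) (sumBelow k (f ∘ suc)) (sumBelow k (g ∘ suc)))

sumBelow-suc : ∀ k (f : ℕ → ℕ) → sumBelow (suc k) f ≡ sumBelow k f + f k
sumBelow-suc zero f = +-identityʳ (f 0)
sumBelow-suc (suc k) f =
  trans (cong (f 0 +_) (sumBelow-suc k (f ∘ suc))) (sym (+-assoc (f 0) _ _))

sumBelow-distrib : ∀ k (c f g : ℕ → ℕ) →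
  sumBelow k (λ i → c i * (f i + g i)) ≡ sumBelow k (λ i → c i * f i) + sumBelow k (λ i → c i * g i)
sumBelow-distrib k c f g =
  trans (sumBelow-cong k (λ i → *-distribˡ-+ (c i) (f i) (g i))) (sumBelow-+ k (λ i → c i * f i) (λ i → c i * g i))

sumBelow-pascal : ∀ n (X : ℕ → ℕ) →
  sumBelow (suc (suc n)) (λ i → (suc n C i) * X i) ≡ sumBelow (suc n) (λ i → (n C i) * (X (suc i) + X i))
sumBelow-pascal n X = begin
    1 * X 0 + sumBelow (suc n) (λ i → (suc n C suc i) * X (suc i))
  ≡⟨ cong (1 * X 0 +_) (sumBelow-cong (suc n) pascal) ⟩
    1 * X 0 + sumBelow (suc n) (λ i → (n C i) * X (suc i) + (n C suc i) * X (suc i))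
  ≡⟨ cong (1 * X 0 +_) (sumBelow-+ (suc n) (λ i → (n C i) * X (suc i)) (λ i → (n C suc i) * X (suc i))) ⟩
    1 * X 0 + (P + sumBelow (suc n) (λ i → (n C suc i) * X (suc i)))
  ≡⟨ cong (λ t → 1 * X 0 + (P + t)) (sumBelow-suc n (λ i → (n C suc i) * X (suc i))) ⟩
    1 * X 0 + (P + (Q + (n C suc n) * X (suc n)))
  ≡⟨ cong (λ t → 1 * X 0 + (P + (Q + t * X (suc n)))) (k>n⇒nCk≡0 (n<1+n n)) ⟩
    1 * X 0 + (P + (Q + 0))
  ≡⟨ cong (λ t → 1 * X 0 + (P + t)) (+-identityʳ Q) ⟩
    1 * X 0 + (P + Q)
  ≡⟨ x∙yz≈y∙xz (1 * X 0) P Q ⟩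
    P + (1 * X 0 + Q)
  ≡⟨ sym (sumBelow-distrib (suc n) (n C_) (X ∘ suc) X) ⟩
    sumBelow (suc n) (λ i → (n C i) * (X (suc i) + X i))
  ∎
  where
  open ≡-Reasoning
  P = sumBelow (suc n) (λ i → (n C i) * X (suc i))
  Q = sumBelow n (λ i → (n C suc i) * X (suc i))
  pascal : ∀ i → (suc n C suc i) * X (suc i) ≡ (n C i) * X (suc i) + (n C suc i) * X (suc i)
  pascal i = trans (cong (_* X (suc i)) (sym (nCk+nC[k+1]≡[n+1]C[k+1] n i)))
                   (*-distribʳ-+ (X (suc i)) (n C i) (n C suc i))

Perm : ℕ → List ℕ → Set
Perm n π = π ↭ applyDownFrom suc n

insertEverywhere-↭ : ∀ x xs → All (_↭ x ∷ xs) (insertEverywhere x xs)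
insertEverywhere-↭ x [] = ↭-refl ∷ []
insertEverywhere-↭ x (y ∷ ys) =
  ↭-refl ∷ map⁺ (All.map (λ p → ↭-trans (prep y p) (swap y x ↭-refl)) (insertEverywhere-↭ x ys))

Perm-insert : ∀ {n π} → Perm n π → All (Perm (suc n)) (insertEverywhere (suc n) π)
Perm-insert {n} p = All.map (λ q → ↭-trans q (prep (suc n) p)) (insertEverywhere-↭ (suc n) _)

S-Perm : ∀ n → All (Perm n) (S n)
S-Perm zero = ↭-refl ∷ []
S-Perm (suc n) = concat⁺ (map⁺ (All.map Perm-insert (S-Perm n)))

module _ {n : ℕ} {π : List ℕ} (p : Perm n π) where

  Perm⇒Unique : Unique π
  Perm⇒Unique = Unique-resp-↭ (↭⇒↭ₛ (↭-sym p))
    (Unique.applyDownFrom⁺₁ suc n (λ j<i _ e → <⇒≢ j<i (sym (suc-injective e))))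

  Perm⇒bounded : All (λ x → 1 ≤ x × x ≤ n) π
  Perm⇒bounded = All-resp-↭ (↭-sym p) (applyDownFrom⁺₁ suc n (λ i<n → s≤s z≤n , i<n))

  Perm⇒below : All (_< suc n) π
  Perm⇒below = All.map (s≤s ∘ proj₂) Perm⇒bounded

  Perm⇒length : length π ≡ n
  Perm⇒length = trans (↭-length p) (length-applyDownFrom suc n)

Perm-∋ : ∀ {n π x} → Perm n π → 1 ≤ x → x ≤ n → x ∈ π
Perm-∋ {x = suc i} p _ i<n = ∈-resp-↭ (↭-sym p) (∈-applyDownFrom⁺ suc i<n)

Unique-++ˡ : ∀ (xs : List A) {ys} → Unique (xs ++ ys) → Unique xs
Unique-++ˡ [] _ = []
Unique-++ˡ (x ∷ xs) (x∉ ∷ u) = ++⁻ˡ xs x∉ ∷ Unique-++ˡ xs u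

Unique-++ʳ : ∀ (xs : List A) {ys} → Unique (xs ++ ys) → Unique ys
Unique-++ʳ [] u = u
Unique-++ʳ (x ∷ xs) (_ ∷ u) = Unique-++ʳ xs u

Unique⇒disjoint : ∀ (xs : List A) {ys x} → Unique (xs ++ ys) → x ∈ xs → x ∈ ys → ⊥
Unique⇒disjoint (a ∷ xs) (a∉ ∷ _) (here refl) x∈ys = All.lookup a∉ (∈-++⁺ʳ xs x∈ys) refl
Unique⇒disjoint (a ∷ xs) (_ ∷ uq) (there x∈xs) x∈ys = Unique⇒disjoint xs uq x∈xs x∈ys

Unique⇒∉prefix : ∀ (u : List A) {x v} → Unique (u ++ x ∷ v) → x ∉ u
Unique⇒∉prefix (a ∷ u) (a∉ ∷ _) (here refl) = All.lookup a∉ (∈-insert u) refl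
Unique⇒∉prefix (a ∷ u) (_ ∷ uq) (there x∈u) = Unique⇒∉prefix u uq x∈u

Unique-prefix : ∀ (p u : List A) {y s t} → Unique (p ++ y ∷ s) → p ++ y ∷ s ≡ u ++ y ∷ t → p ≡ u
Unique-prefix [] [] _ _ = refl
Unique-prefix [] (a ∷ u) (y∉ ∷ _) e with ∷-injective e
... | refl , refl = ⊥-elim (All.lookup y∉ (∈-insert u) refl)
Unique-prefix (a ∷ p) [] uq e with ∷-injective e
... | refl , _ = ⊥-elim (Unique⇒∉prefix (a ∷ p) uq (here refl))
Unique-prefix (a ∷ p) (b ∷ u) (_ ∷ uq) e with ∷-injective e
... | refl , e′ = cong (a ∷_) (Unique-prefix p u uq e′)

locate-in-++ : ∀ (b : List A) {L} u {y w} → Unique (b ++ L) → b ++ L ≡ u ++ y ∷ w →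
         (∃ λ q → b ≡ u ++ y ∷ q × w ≡ q ++ L)
       ⊎ (y ∉ b × ∃ λ u′ → u ≡ b ++ u′ × L ≡ u′ ++ y ∷ w)
locate-in-++ [] u _ e = inj₂ ((λ ()) , u , refl , e)
locate-in-++ (a ∷ b) [] _ refl = inj₁ (b , refl , refl)
locate-in-++ (a ∷ b) (c ∷ u) (a∉ ∷ uq) e with ∷-injective e
... | refl , e′ with locate-in-++ b u uq e′
... | inj₁ (q , refl , refl) = inj₁ (q , refl , refl)
... | inj₂ (y∉b , u′ , refl , refl) = inj₂ (y∉a∷b , u′ , refl , refl)
  where
  y∉a∷b : _ ∉ a ∷ b
  y∉a∷b (here refl) = All.lookup a∉ (∈-++⁺ʳ b (∈-insert u′)) refl
  y∉a∷b (there y∈b) = y∉b y∈b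

-- The blocks of θ⁻¹ and the map π̂

≡ᵇ-reflects-≡ : ∀ m n → Reflects (m ≡ n) (m ≡ᵇ n)
≡ᵇ-reflects-≡ m n = fromEquivalence (≡ᵇ⇒≡ m n) (≡⇒≡ᵇ m n)

succIn-skip : ∀ f a c x → x ≢ a → succIn f (a ∷ c) x ≡ succIn f c x
succIn-skip f a [] x x≢a with x ≡ᵇ a | ≡ᵇ-reflects-≡ x a
... | true | ofʸ x≡a = ⊥-elim (x≢a x≡a)
... | false | _ = refl
succIn-skip f a (b ∷ c) x x≢a with x ≡ᵇ a | ≡ᵇ-reflects-≡ x a
... | true | ofʸ x≡a = ⊥-elim (x≢a x≡a)
... | false | _ = refl

succIn-∉ : ∀ f c x → x ∉ c → succIn f c x ≡ nothing
succIn-∉ f [] x _ = refl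
succIn-∉ f (a ∷ c) x x∉ = trans (succIn-skip f a c x (x∉ ∘ here)) (succIn-∉ f c x (x∉ ∘ there))

succIn-next : ∀ f p x z q → x ∉ p → succIn f (p ++ x ∷ z ∷ q) x ≡ just z
succIn-next f [] x z q _ rewrite T-≡ .to (≡⇒≡ᵇ x x refl) = refl
succIn-next f (a ∷ p) x z q x∉ =
  trans (succIn-skip f a (p ++ x ∷ z ∷ q) x (x∉ ∘ here)) (succIn-next f p x z q (x∉ ∘ there))

succIn-last : ∀ f p x → x ∉ p → succIn f (p ++ x ∷ []) x ≡ just f
succIn-last f [] x _ rewrite T-≡ .to (≡⇒≡ᵇ x x refl) = refl
succIn-last f (a ∷ p) x x∉ = trans (succIn-skip f a (p ++ x ∷ []) x (x∉ ∘ here)) (succIn-last f p x (x∉ ∘ there))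

imageIn-here : ∀ c cs x {y} → cycImage c x ≡ just y → imageIn (c ∷ cs) x ≡ y
imageIn-here c cs x e rewrite e = refl

imageIn-skip : ∀ f r cs x → x ∉ f ∷ r → imageIn ((f ∷ r) ∷ cs) x ≡ imageIn cs x
imageIn-skip f r cs x x∉ rewrite succIn-∉ f (f ∷ r) x x∉ = refl

Blocks : ℕ → List (List ℕ) → Set
Blocks m [] = ⊤
Blocks m ([] ∷ bs) = ⊥
Blocks m ((f ∷ r) ∷ bs) = m < f × All (_≤ f) r × Blocks f bs

NextAbove : ℕ → List ℕ → Set
NextAbove x v = Maybe.All (x <_) (head v)

Blocks⇒NextAbove : ∀ {f} cs → Blocks f cs → NextAbove f (concat cs)
Blocks⇒NextAbove [] _ = nothing
Blocks⇒NextAbove ((g ∷ r) ∷ cs) (f<g , _) = just f<g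

head-maximal : ∀ {f r x} → All (_≤ f) r → x ∈ f ∷ r → x ≤ f
head-maximal _ (here refl) = ≤-refl
head-maximal r≤f (there x∈r) = All.lookup r≤f x∈r

cycs-Blocks : ∀ {M m} r xs → M < m → All (_≤ m) r → Blocks M (cycs m (m ∷ r) xs)
cycs-Blocks r [] M<m r≤m = M<m , r≤m , tt
cycs-Blocks {m = m} r (x ∷ xs) M<m r≤m with m <ᵇ x | <ᵇ-reflects-< m x
... | true | ofʸ m<x = M<m , r≤m , cycs-Blocks [] xs m<x []
... | false | ofⁿ m≮x = cycs-Blocks (r ++ x ∷ []) xs M<m (++⁺ r≤m (≮⇒≥ m≮x ∷ []))

concat-cycs : ∀ m cur xs → concat (cycs m cur xs) ≡ cur ++ xs
concat-cycs m cur [] = refl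
concat-cycs m cur (x ∷ xs) with m <ᵇ x
... | true = cong (cur ++_) (concat-cycs x (x ∷ []) xs)
... | false = trans (concat-cycs m (cur ++ x ∷ []) xs) (++-assoc cur (x ∷ []) xs)

cycles-Blocks : ∀ π → All (0 <_) π → Blocks 0 (cycles π)
cycles-Blocks [] _ = tt
cycles-Blocks (x ∷ xs) (0<x ∷ _) = cycs-Blocks [] xs 0<x []

concat-cycles : ∀ π → concat (cycles π) ≡ π
concat-cycles [] = refl
concat-cycles (x ∷ xs) = concat-cycs x (x ∷ []) xs

module _ {f : ℕ} {r : List ℕ} (cs : List (List ℕ)) (u : List ℕ) {x : ℕ} (uq : Unique (f ∷ r)) where

  imageIn-next : ∀ {z q} → f ∷ r ≡ u ++ x ∷ z ∷ q → imageIn ((f ∷ r) ∷ cs) x ≡ z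
  imageIn-next {z} {q} eb = imageIn-here (f ∷ r) cs x
    (trans (cong (λ c → succIn f c x) eb) (succIn-next f u x z q (Unique⇒∉prefix u (subst Unique eb uq))))

  imageIn-last : f ∷ r ≡ u ++ x ∷ [] → imageIn ((f ∷ r) ∷ cs) x ≡ f
  imageIn-last eb = imageIn-here (f ∷ r) cs x
    (trans (cong (λ c → succIn f c x) eb) (succIn-last f u x (Unique⇒∉prefix u (subst Unique eb uq))))

image<⇒next : ∀ {M} bs u {x w} → Blocks M bs → Unique (concat bs) →
              concat bs ≡ u ++ x ∷ w → imageIn bs x < x → ∃ λ w′ → w ≡ imageIn bs x ∷ w′
image<⇒next [] u _ _ _ lt = ⊥-elim (<-irrefl refl lt)
image<⇒next ((f ∷ r) ∷ cs) u {x} (_ , r≤f , ok) uq e lt with locate-in-++ (f ∷ r) u uq e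
... | inj₂ (x∉ , u′ , _ , e′) rewrite imageIn-skip f r cs x x∉ =
  image<⇒next cs u′ ok (Unique-++ʳ (f ∷ r) uq) e′ lt
... | inj₁ ([] , eb , _) rewrite imageIn-last cs u (Unique-++ˡ (f ∷ r) uq) eb =
  ⊥-elim (<⇒≱ lt (head-maximal r≤f (subst (x ∈_) (sym eb) (∈-insert u))))
... | inj₁ (z ∷ q , eb , refl) rewrite imageIn-next cs u (Unique-++ˡ (f ∷ r) uq) eb =
  q ++ concat cs , refl

descent⇒image : ∀ {M} bs u {y z v} → Blocks M bs → Unique (concat bs) →
                concat bs ≡ u ++ y ∷ z ∷ v → z < y → imageIn bs y ≡ z
descent⇒image [] [] _ _ () _
descent⇒image [] (_ ∷ _) _ _ () _
descent⇒image ((f ∷ r) ∷ cs) u {y} (_ , r≤f , ok) uq e z<y with locate-in-++ (f ∷ r) u uq e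
... | inj₂ (y∉ , u′ , _ , e′) =
  trans (imageIn-skip f r cs y y∉) (descent⇒image cs u′ ok (Unique-++ʳ (f ∷ r) uq) e′ z<y)
... | inj₁ (z′ ∷ q , eb , refl) = imageIn-next cs u (Unique-++ˡ (f ∷ r) uq) eb
... | inj₁ ([] , eb , ev) with subst (NextAbove f) (sym ev) (Blocks⇒NextAbove cs ok)
...   | just f<z =
  ⊥-elim (<⇒≱ z<y (<⇒≤ (≤-<-trans (head-maximal r≤f (subst (y ∈_) (sym eb) (∈-insert u))) f<z)))

fixed⇒singleton : ∀ {M} bs u {x v} → Blocks M bs → Unique (concat bs) →
                  concat bs ≡ u ++ x ∷ v → imageIn bs x ≡ x → All (_< x) u × NextAbove x v × M < x
fixed⇒singleton [] [] _ _ () _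
fixed⇒singleton [] (_ ∷ _) _ _ () _
fixed⇒singleton ((f ∷ r) ∷ cs) u {x} (M<f , r≤f , ok) uq e fix with locate-in-++ (f ∷ r) u uq e
... | inj₂ (x∉ , u′ , refl , e′)
  with fixed⇒singleton cs u′ ok (Unique-++ʳ (f ∷ r) uq) e′ (trans (sym (imageIn-skip f r cs x x∉)) fix)
...   | u′<x , next , f<x = ++⁺ (f<x ∷ All.map (λ y≤f → ≤-<-trans y≤f f<x) r≤f) u′<x , next , <-trans M<f f<x
fixed⇒singleton ((f ∷ r) ∷ cs) u {x} (M<f , r≤f , ok) uq e fix | inj₁ (z ∷ q , eb , _)
  with Unique-++ʳ u (subst Unique eb (Unique-++ˡ (f ∷ r) uq))
...   | x∉ ∷ _ = ⊥-elim (All.lookup x∉ (here refl) (trans (sym fix) (imageIn-next cs u (Unique-++ˡ (f ∷ r) uq) eb)))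
fixed⇒singleton ((f ∷ r) ∷ cs) [] {x} (M<f , r≤f , ok) uq e fix | inj₁ ([] , eb , refl)
  with ∷-injective eb
... | refl , refl = [] , Blocks⇒NextAbove cs ok , M<f
fixed⇒singleton ((f ∷ r) ∷ cs) (a ∷ u) {x} (M<f , r≤f , ok) uq e fix | inj₁ ([] , eb , _)
  with ∷-injective eb
... | refl , _ = ⊥-elim (Unique⇒∉prefix (f ∷ u) (subst Unique eb (Unique-++ˡ (f ∷ r) uq))
                           (here (trans (sym fix) (imageIn-last cs (f ∷ u) (Unique-++ˡ (f ∷ r) uq) eb))))

block-singleton⇒fixed : ∀ {f r} cs u {x} q → All (_≤ f) r → Unique (f ∷ r) → f ∷ r ≡ u ++ x ∷ q →
                        All (_< x) u → NextAbove x (q ++ concat cs) → imageIn ((f ∷ r) ∷ cs) x ≡ x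
block-singleton⇒fixed cs (a ∷ u) {x} q r≤f _ eb (a<x ∷ _) _ with ∷-injective eb
... | refl , _ = ⊥-elim (<⇒≱ a<x (head-maximal r≤f (subst (x ∈_) (sym eb) (∈-insert (a ∷ u)))))
block-singleton⇒fixed cs [] [] r≤f uq eb [] _ with ∷-injective eb
... | refl , refl = imageIn-last cs [] uq eb
block-singleton⇒fixed cs [] (z ∷ q) r≤f _ eb [] (just x<z) with ∷-injective eb
... | refl , refl = ⊥-elim (<⇒≱ x<z (All.lookup r≤f (here refl)))

singleton⇒fixed : ∀ {M} bs u {x v} → Blocks M bs → Unique (concat bs) →
                  concat bs ≡ u ++ x ∷ v → All (_< x) u → NextAbove x v → imageIn bs x ≡ x
singleton⇒fixed [] [] _ _ () _ _
singleton⇒fixed [] (_ ∷ _) _ _ () _ _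
singleton⇒fixed ((f ∷ r) ∷ cs) u {x} (_ , r≤f , ok) uq e u<x next with locate-in-++ (f ∷ r) u uq e
... | inj₂ (x∉ , u′ , refl , e′) =
  trans (imageIn-skip f r cs x x∉) (singleton⇒fixed cs u′ ok (Unique-++ʳ (f ∷ r) uq) e′ (++⁻ʳ (f ∷ r) u<x) next)
... | inj₁ (q , eb , refl) = block-singleton⇒fixed cs u q r≤f (Unique-++ˡ (f ∷ r) uq) eb u<x next

module HatOfPerm {n : ℕ} {π : List ℕ} (p : Perm n π) where

  private
    blocks : Blocks 0 (cycles π)
    blocks = cycles-Blocks π (All.map proj₁ (Perm⇒bounded p))

    unique : Unique (concat (cycles π))
    unique = subst Unique (sym (concat-cycles π)) (Perm⇒Unique p)

    located : ∀ {u x w} → π ≡ u ++ x ∷ w → concat (cycles π) ≡ u ++ x ∷ w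
    located = trans (concat-cycles π)

  hat<⇒next : ∀ u {x w} → π ≡ u ++ x ∷ w → hat π x < x → ∃ λ w′ → w ≡ hat π x ∷ w′
  hat<⇒next u e = image<⇒next (cycles π) u blocks unique (located e)

  descent⇒hat : ∀ u {y z v} → π ≡ u ++ y ∷ z ∷ v → z < y → hat π y ≡ z
  descent⇒hat u e = descent⇒image (cycles π) u blocks unique (located e)

  hat-fixed⇒singleton : ∀ u {x v} → π ≡ u ++ x ∷ v → hat π x ≡ x → All (_< x) u × NextAbove x v
  hat-fixed⇒singleton u e fix with fixed⇒singleton (cycles π) u blocks unique (located e) fix
  ... | u<x , next , _ = u<x , next

  singleton⇒hat-fixed : ∀ u {x v} → π ≡ u ++ x ∷ v → All (_< x) u → NextAbove x v → hat π x ≡ x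
  singleton⇒hat-fixed u e = singleton⇒fixed (cycles π) u blocks unique (located e)

-- Occurrences of arrow patterns

AscendingFrom : ℕ → List ℕ → Set
AscendingFrom lo [] = ⊤
AscendingFrom lo (x ∷ xs) = lo ≤ x × AscendingFrom (suc x) xs

AscendingFrom-weaken : ∀ {lo lo′} xs → lo′ ≤ lo → AscendingFrom lo xs → AscendingFrom lo′ xs
AscendingFrom-weaken [] _ _ = tt
AscendingFrom-weaken (x ∷ xs) lo′≤lo (lo≤x , asc) = ≤-trans lo′≤lo lo≤x , asc

private
  shift-bound : ∀ lo r {x} → x < suc lo + r → x < lo + suc r
  shift-bound lo r {x} = subst (x <_) (sym (+-suc lo r))

  unshift-bound : ∀ lo r {x} → x < lo + suc r → x < suc lo + r
  unshift-bound lo r {x} = subst (x <_) (+-suc lo r)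

∈-subsetsFrom⁻ : ∀ lo r k {X} → X ∈ subsetsFrom lo r k →
                 length X ≡ k × AscendingFrom lo X × All (_< lo + r) X
∈-subsetsFrom⁻ lo r zero (here refl) = refl , tt , []
∈-subsetsFrom⁻ lo (suc r) (suc k) X∈ with ∈-++⁻ (map (lo ∷_) (subsetsFrom (suc lo) r k)) X∈
... | inj₁ X∈₁ with ∈-map⁻ (lo ∷_) X∈₁
...   | Y , Y∈ , refl with ∈-subsetsFrom⁻ (suc lo) r k Y∈
...     | len , asc , bnd =
  cong suc len , (≤-refl , asc) , shift-bound lo r (s≤s (m≤m+n lo r)) ∷ All.map (shift-bound lo r) bnd
∈-subsetsFrom⁻ lo (suc r) (suc k) X∈ | inj₂ X∈₂ with ∈-subsetsFrom⁻ (suc lo) r (suc k) X∈₂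
... | len , asc , bnd = len , AscendingFrom-weaken _ (n≤1+n lo) asc , All.map (shift-bound lo r) bnd

∈-subsetsFrom⁺ : ∀ lo r X → AscendingFrom lo X → All (_< lo + r) X → X ∈ subsetsFrom lo r (length X)
∈-subsetsFrom⁺ lo r [] _ _ = here refl
∈-subsetsFrom⁺ lo zero (x ∷ X) (lo≤x , _) (x<lo+0 ∷ _) =
  ⊥-elim (<⇒≱ (subst (x <_) (+-identityʳ lo) x<lo+0) lo≤x)
∈-subsetsFrom⁺ lo (suc r) (x ∷ X) (lo≤x , asc) bnd with m≤n⇒m<n∨m≡n lo≤x
... | inj₂ refl =
  ∈-++⁺ˡ (∈-map⁺ (lo ∷_) (∈-subsetsFrom⁺ (suc lo) r X asc (All.map (unshift-bound lo r) (All.tail bnd))))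
... | inj₁ lo<x = ∈-++⁺ʳ _ (∈-subsetsFrom⁺ (suc lo) r (x ∷ X) (lo<x , asc) (All.map (unshift-bound lo r) bnd))

∈-subseqs⁻ : ∀ m π {s} → s ∈ subseqs m π → s ⊆ π
∈-subseqs⁻ zero π (here refl) = minimum π
∈-subseqs⁻ (suc m) (x ∷ π) s∈ with ∈-++⁻ (map (x ∷_) (subseqs m π)) s∈
... | inj₁ s∈₁ with ∈-map⁻ (x ∷_) s∈₁
...   | t , t∈ , refl = refl ∷ ∈-subseqs⁻ m π t∈
∈-subseqs⁻ (suc m) (x ∷ π) s∈ | inj₂ s∈₂ = x ∷ʳ ∈-subseqs⁻ (suc m) π s∈₂

∈-subseqs⁺ : ∀ {s π} → s ⊆ π → s ∈ subseqs (length s) π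
∈-subseqs⁺ [] = here refl
∈-subseqs⁺ {[]} (y ∷ʳ _) = here refl
∈-subseqs⁺ {_ ∷ _} (y ∷ʳ τ) = ∈-++⁺ʳ _ (∈-subseqs⁺ τ)
∈-subseqs⁺ (refl ∷ τ) = ∈-++⁺ˡ (∈-map⁺ (_ ∷_) (∈-subseqs⁺ τ))

listEq⇒≡ : ∀ s t → T (listEq s t) → s ≡ t
listEq⇒≡ [] [] _ = refl
listEq⇒≡ (x ∷ s) (y ∷ t) eq with T-∧ .to eq
... | x≡ᵇy , s≡t = cong₂ _∷_ (≡ᵇ⇒≡ x y x≡ᵇy) (listEq⇒≡ s t s≡t)

listEq-refl : ∀ s → T (listEq s s)
listEq-refl [] = tt
listEq-refl (x ∷ s) = T-∧ .from (≡⇒≡ᵇ x x refl , listEq-refl s)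

record Occurrence (π : List ℕ) (p : ArrowPattern) : Set where
  field
    X : List ℕ
    ascending : AscendingFrom 1 X
    bounded : All (_≤ length π) X
    size≡ : length X ≡ size p
    word⊆π : map (nth X) (ν p) ⊆ π
    arrows : All (uncurry λ b c → hat π (nth X b) ≡ nth X c) (H p)

contains⇒Occurrence : ∀ π p → T (contains π p) → Occurrence π p
contains⇒Occurrence π p c with find (any⁻ _ _ c)
... | X , X∈ , body with T-∧ .to body | ∈-subsetsFrom⁻ 1 (length π) (size p) X∈
...   | word∈ , arrows∈ | size≡ , asc , bnd
  with find (any⁻ (λ s → listEq s (map (nth X) (ν p))) (subseqs (length (ν p)) π) word∈)
...     | s , s∈ , s≡ = record
  { X = X
  ; ascending = asc
  ; bounded = All.map s≤s⁻¹ bnd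
  ; size≡ = size≡
  ; word⊆π = subst (_⊆ π) (listEq⇒≡ s (map (nth X) (ν p)) s≡) (∈-subseqs⁻ (length (ν p)) π s∈)
  ; arrows = All.map (λ { {b , c} t → ≡ᵇ⇒≡ _ _ t }) (all⁺ _ (H p) arrows∈)
  }

Occurrence⇒contains : ∀ π p → Occurrence π p → T (contains π p)
Occurrence⇒contains π p o =
  any⁺ _ (lose X∈ (T-∧ .from ( any⁺ _ (lose word∈ (listEq-refl word))
                              , all⁻ _ (All.map (λ { {b , c} → ≡⇒≡ᵇ _ _ }) arrows))))
  where
  open Occurrence o
  word : List ℕ
  word = map (nth X) (ν p)
  X∈ : X ∈ subsets (length π) (size p)
  X∈ = subst (λ k → X ∈ subsets (length π) k) size≡
             (∈-subsetsFrom⁺ 1 (length π) X ascending (All.map s≤s bounded))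
  word∈ : word ∈ subseqs (length (ν p)) π
  word∈ = subst (λ m → word ∈ subseqs m π) (length-map (nth X) (ν p)) (∈-subseqs⁺ word⊆π)

NonMinimalDescent : List ℕ → Set
NonMinimalDescent π = ∃₂ λ u y → ∃₂ λ z v → ∃ λ w →
  π ≡ u ++ y ∷ z ∷ v × z < y × w ∈ u × w < z

SingletonBlock : List ℕ → Set
SingletonBlock π = ∃₂ λ u x → ∃ λ v → π ≡ u ++ x ∷ v × All (_< x) u × NextAbove x v

pair⊆⇒ : ∀ {a b : A} {π} → a ∷ b ∷ [] ⊆ π → ∃₂ λ p q → π ≡ p ++ b ∷ q × a ∈ p
pair⊆⇒ (y ∷ʳ τ) with pair⊆⇒ τ
... | p , q , refl , a∈p = y ∷ p , q , refl , there a∈p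
pair⊆⇒ (refl ∷ τ) with ∈-∃++ (to∈ τ)
... | p , q , refl = _ ∷ p , q , refl , here refl

module _ {n : ℕ} {π : List ℕ} (perm : Perm n π) where

  open HatOfPerm perm

  private
    bounded : ∀ {x} → x ∈ π → 1 ≤ x × x ≤ length π
    bounded x∈ with All.lookup (Perm⇒bounded perm) x∈
    ... | 1≤x , x≤n = 1≤x , subst (_ ≤_) (sym (Perm⇒length perm)) x≤n

  contains-p12⇒ : T (contains π p12-3→2) → NonMinimalDescent π
  contains-p12⇒ c with contains⇒Occurrence π p12-3→2 c
  ... | record { X = x₁ ∷ x₂ ∷ x₃ ∷ [] ; ascending = _ , x₁<x₂ , x₂<x₃ , _
               ; bounded = _ ∷ _ ∷ x₃≤ ∷ [] ; word⊆π = τ ; arrows = hat≡ ∷ [] }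
    with ∈-∃++ (Perm-∋ perm (≤-trans (s≤s z≤n) x₂<x₃) (subst (_ ≤_) (Perm⇒length perm) x₃≤))
  ... | u , w , e with hat<⇒next u e (subst (_< x₃) (sym hat≡) x₂<x₃)
  ... | w′ , refl with pair⊆⇒ τ | subst (λ z → π ≡ u ++ x₃ ∷ z ∷ w′) hat≡ e
  ... | p , q , e₂ , x₁∈p | e′ with ∈-++⁻ u (subst (x₁ ∈_) p≡ x₁∈p)
    where
    p≡ : p ≡ u ++ x₃ ∷ []
    p≡ = Unique-prefix p (u ++ x₃ ∷ []) (subst Unique e₂ (Perm⇒Unique perm))
           (trans (sym e₂) (trans e′ (sym (++-assoc u (x₃ ∷ []) (x₂ ∷ w′)))))
  ... | inj₁ x₁∈u = u , x₃ , x₂ , w′ , x₁ , e′ , x₂<x₃ , x₁∈u , x₁<x₂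
  ... | inj₂ (here refl) = ⊥-elim (<-asym x₁<x₂ x₂<x₃)

  contains-p12⇐ : NonMinimalDescent π → T (contains π p12-3→2)
  contains-p12⇐ (u , y , z , v , w , e , z<y , w∈u , w<z) = Occurrence⇒contains π p12-3→2 record
    { X = w ∷ z ∷ y ∷ []
    ; ascending = proj₁ (bounded w∈π) , w<z , z<y , tt
    ; bounded = proj₂ (bounded w∈π) ∷ proj₂ (bounded z∈π) ∷ proj₂ (bounded y∈π) ∷ []
    ; size≡ = refl
    ; word⊆π = subst (w ∷ z ∷ [] ⊆_) (sym e) (Sublist.++⁺ (from∈ w∈u) (from∈ (there (here refl))))
    ; arrows = descent⇒hat u e z<y ∷ []
    }
    where
    w∈π = subst (w ∈_) (sym e) (∈-++⁺ˡ w∈u)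
    y∈π = subst (y ∈_) (sym e) (∈-insert u)
    z∈π = subst (z ∈_) (sym e) (∈-++⁺ʳ u (there (here refl)))

  contains-p1⇒ : T (contains π p1-1→1) → SingletonBlock π
  contains-p1⇒ c with contains⇒Occurrence π p1-1→1 c
  ... | record { X = x ∷ [] ; word⊆π = τ ; arrows = fix ∷ [] } with ∈-∃++ (to∈ τ)
  ... | u , v , e = u , x , v , e , hat-fixed⇒singleton u e fix

  contains-p1⇐ : SingletonBlock π → T (contains π p1-1→1)
  contains-p1⇐ (u , x , v , e , u<x , next) = Occurrence⇒contains π p1-1→1 record
    { X = x ∷ []
    ; ascending = proj₁ (bounded x∈π) , tt
    ; bounded = proj₂ (bounded x∈π) ∷ []
    ; size≡ = refl
    ; word⊆π = from∈ x∈π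
    ; arrows = singleton⇒hat-fixed u e u<x next ∷ []
    }
    where
    x∈π = subst (x ∈_) (sym e) (∈-insert u)

-- A left-to-right scan deciding avoidance

-- The state after reading a nonempty prefix: its maximum, its minimum, its last letter, and whether
-- the last letter is a left-to-right maximum, i.e. opens a block of θ⁻¹ that is so far a singleton.
record Scan : Set where
  constructor scan
  field
    top bottom last : ℕ
    alone : Bool
open Scan

admits : Scan → ℕ → Bool
admits (scan M m l a) x = if M <ᵇ x then not a else (if x <ᵇ l then x <ᵇ m else true)

step : Scan → ℕ → Scan
step (scan M m l a) x =
  if M <ᵇ x then scan x m x true else (if x <ᵇ l then scan M x x false else scan M m x false)

admitsAll : Scan → List ℕ → Bool
admitsAll s [] = true
admitsAll s (x ∷ xs) = admits s x ∧ admitsAll (step s x) xs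

run : Scan → List ℕ → Scan
run s [] = s
run s (x ∷ xs) = run (step s x) xs

accepts : Scan → List ℕ → Bool
accepts s w = admitsAll s w ∧ not (alone (run s w))

start : ℕ → Scan
start x = scan x x x true

nearlyAdmissible : List ℕ → Bool
nearlyAdmissible [] = true
nearlyAdmissible (x ∷ xs) = admitsAll (start x) xs

endsAlone : List ℕ → Bool
endsAlone [] = false
endsAlone (x ∷ xs) = alone (run (start x) xs)

admissible : List ℕ → Bool
admissible π = nearlyAdmissible π ∧ not (endsAlone π)

admitsAll-++ : ∀ s xs ys → admitsAll s (xs ++ ys) ≡ admitsAll s xs ∧ admitsAll (run s xs) ys
admitsAll-++ s [] ys = refl
admitsAll-++ s (x ∷ xs) ys =
  trans (cong (admits s x ∧_) (admitsAll-++ (step s x) xs ys)) (sym (∧-assoc (admits s x) _ _))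

run-++ : ∀ s xs ys → run s (xs ++ ys) ≡ run (run s xs) ys
run-++ s [] ys = refl
run-++ s (x ∷ xs) ys = run-++ (step s x) xs ys

accepts-++ : ∀ s xs ys → accepts s (xs ++ ys) ≡ admitsAll s xs ∧ accepts (run s xs) ys
accepts-++ s xs ys = trans (cong₂ (λ b t → b ∧ not (alone t)) (admitsAll-++ s xs ys) (run-++ s xs ys))
                           (∧-assoc (admitsAll s xs) _ _)

accepts-∷ : ∀ s x w → accepts s (x ∷ w) ≡ admits s x ∧ accepts (step s x) w
accepts-∷ s x w = ∧-assoc (admits s x) (admitsAll (step s x) w) (not (alone (run (step s x) w)))

record Represents (s : Scan) (pre : List ℕ) : Set where
  field
    earlier : List ℕ
    pre≡ : pre ≡ earlier ++ last s ∷ []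
    alone⇒max : T (alone s) → All (_< last s) earlier
    max⇒alone : All (_< last s) earlier → T (alone s)
    top∈ : top s ∈ pre
    ≤top : All (_≤ top s) pre
    bottom∈ : bottom s ∈ pre
    bottom≤ : All (bottom s ≤_) pre

  last∈ : last s ∈ pre
  last∈ = subst (last s ∈_) (sym pre≡) (∈-insert earlier)

  pre++ : ∀ w → pre ++ w ≡ earlier ++ last s ∷ w
  pre++ w = trans (cong (_++ w) pre≡) (++-assoc earlier (last s ∷ []) w)
open Represents

start-Represents : ∀ p → Represents (start p) (p ∷ [])
start-Represents p = record
  { earlier = [] ; pre≡ = refl ; alone⇒max = λ _ → [] ; max⇒alone = λ _ → tt
  ; top∈ = here refl ; ≤top = ≤-refl ∷ [] ; bottom∈ = here refl ; bottom≤ = ≤-refl ∷ [] }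

Represents-step : ∀ {s pre} x → Represents s pre → T (admits s x) → Represents (step s x) (pre ++ x ∷ [])
Represents-step {scan M m l a} {pre} x R ok with M <ᵇ x | <ᵇ-reflects-< M x
... | true | ofʸ M<x = record
  { earlier = pre ; pre≡ = refl
  ; alone⇒max = λ _ → All.map (λ y≤M → ≤-<-trans y≤M M<x) (≤top R) ; max⇒alone = λ _ → tt
  ; top∈ = ∈-insert pre ; ≤top = ++⁺ (All.map (λ y≤M → <⇒≤ (≤-<-trans y≤M M<x)) (≤top R)) (≤-refl ∷ [])
  ; bottom∈ = ∈-++⁺ˡ (bottom∈ R)
  ; bottom≤ = ++⁺ (bottom≤ R) (<⇒≤ (≤-<-trans (All.lookup (≤top R) (bottom∈ R)) M<x) ∷ []) }
... | false | ofⁿ M≮x with x <ᵇ l | <ᵇ-reflects-< x l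
...   | true | ofʸ x<l = record
  { earlier = pre ; pre≡ = refl
  ; alone⇒max = λ () ; max⇒alone = λ pre<x → <-asym x<l (All.lookup pre<x (last∈ R))
  ; top∈ = ∈-++⁺ˡ (top∈ R) ; ≤top = ++⁺ (≤top R) (≮⇒≥ M≮x ∷ [])
  ; bottom∈ = ∈-insert pre
  ; bottom≤ = ++⁺ (All.map (λ m≤y → <⇒≤ (<-≤-trans (<ᵇ⇒< x m ok) m≤y)) (bottom≤ R)) (≤-refl ∷ []) }
...   | false | ofⁿ x≮l = record
  { earlier = pre ; pre≡ = refl
  ; alone⇒max = λ () ; max⇒alone = λ pre<x → <⇒≱ (All.lookup pre<x (top∈ R)) (≮⇒≥ M≮x)
  ; top∈ = ∈-++⁺ˡ (top∈ R) ; ≤top = ++⁺ (≤top R) (≮⇒≥ M≮x ∷ [])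
  ; bottom∈ = ∈-++⁺ˡ (bottom∈ R)
  ; bottom≤ = ++⁺ (bottom≤ R) (≤-trans (All.lookup (bottom≤ R) (last∈ R)) (≮⇒≥ x≮l) ∷ []) }

Represents-run : ∀ {s pre} xs → Represents s pre → T (admitsAll s xs) → Represents (run s xs) (pre ++ xs)
Represents-run {pre = pre} [] R _ = subst (Represents _) (sym (++-identityʳ pre)) R
Represents-run {pre = pre} (x ∷ xs) R ok with T-∧ .to ok
... | ok₁ , ok₂ = subst (Represents _) (++-assoc pre (x ∷ []) xs)
                        (Represents-run xs (Represents-step x R ok₁) ok₂)

admissible-snoc : ∀ u y {w} → T (admissible ((u ++ y ∷ []) ++ w)) →
                  ∃ λ s → Represents s (u ++ y ∷ []) × T (accepts s w)
admissible-snoc [] y t = start y , start-Represents y , t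
admissible-snoc (a ∷ u) y {w} t with T-∧ .to (subst T (accepts-++ (start a) (u ++ y ∷ []) w) t)
... | ok , acc = _ , Represents-run (u ++ y ∷ []) (start-Represents a) ok , acc

admits-descent : ∀ s z → T (admits s z) → z < last s → last s ≤ top s → z < bottom s
admits-descent (scan M m l a) z ok z<l l≤M with M <ᵇ z | <ᵇ-reflects-< M z
... | true | ofʸ M<z = ⊥-elim (<-asym z<l (≤-<-trans l≤M M<z))
... | false | _ with z <ᵇ l | <ᵇ-reflects-< z l
...   | true | _ = <ᵇ⇒< z m ok
...   | false | ofⁿ z≮l = ⊥-elim (z≮l z<l)

admits-above : ∀ s z → T (admits s z) → top s < z → T (not (alone s))
admits-above (scan M m l a) z ok M<z with M <ᵇ z | <ᵇ-reflects-< M z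
... | true | _ = ok
... | false | ofⁿ M≮z = ⊥-elim (M≮z M<z)

accepts-head : ∀ s z v → T (accepts s (z ∷ v)) → T (admits s z)
accepts-head s z v acc = proj₁ (T-∧ .to (subst T (accepts-∷ s z v) acc))

admissible-prefix : ∀ {π} u y {w} → T (admissible π) → π ≡ u ++ y ∷ w →
                    ∃ λ s → Represents s (u ++ y ∷ []) × T (accepts s w)
admissible-prefix u y {w} t refl = admissible-snoc u y (subst (T ∘ admissible) (sym (++-assoc u (y ∷ []) w)) t)

admissible⇒descent-below : ∀ {π} u {y z v} → T (admissible π) → π ≡ u ++ y ∷ z ∷ v → z < y → All (z <_) u
admissible⇒descent-below u {y} {z} {v} t e z<y with admissible-prefix u y t e
... | s , R , acc with ∷ʳ-injective u (earlier R) (pre≡ R)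
... | _ , y≡ = All.map (<-≤-trans z<bottom) (++⁻ˡ u (bottom≤ R))
  where
  z<bottom : z < bottom s
  z<bottom = admits-descent s z (accepts-head s z v acc) (subst (z <_) y≡ z<y) (All.lookup (≤top R) (last∈ R))

admissible⇒no-singleton : ∀ {π} u {x v} → T (admissible π) → π ≡ u ++ x ∷ v → All (_< x) u → ¬ NextAbove x v
admissible⇒no-singleton u {x} {v} t e u<x next with admissible-prefix u x t e
... | s , R , acc with ∷ʳ-injective u (earlier R) (pre≡ R)
... | u≡ , x≡ = rejects v next acc
  where
  alone-s : T (alone s)
  alone-s = max⇒alone R (subst₂ (λ e l → All (_< l) e) u≡ x≡ u<x)
  top≤x : top s ≤ x
  top≤x = All.lookup (++⁺ (All.map <⇒≤ u<x) (≤-refl ∷ [])) (top∈ R)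
  rejects : ∀ v → NextAbove x v → ¬ T (accepts s v)
  rejects [] nothing acc′ = subst (T ∘ not) (T-≡ .to alone-s) (proj₂ (T-∧ .to acc′))
  rejects (z ∷ v′) (just x<z) acc′ =
    subst (T ∘ not) (T-≡ .to alone-s) (admits-above s z (accepts-head s z v′ acc′) (≤-<-trans top≤x x<z))

Violation : List ℕ → Set
Violation π = NonMinimalDescent π ⊎ SingletonBlock π

rejected-at : ∀ {s pre} x w → Represents s pre → Unique (pre ++ x ∷ w) → ¬ T (admits s x) →
              Violation (pre ++ x ∷ w)
rejected-at {scan M m l a} {pre} x w R uq bad with M <ᵇ x | <ᵇ-reflects-< M x
... | true | ofʸ M<x =
  inj₂ (earlier R , l , x ∷ w , pre++ R (x ∷ w) , alone⇒max R (¬T-not⇒T a bad)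
       , just (≤-<-trans (All.lookup (≤top R) (last∈ R)) M<x))
... | false | ofⁿ _ with x <ᵇ l | <ᵇ-reflects-< x l
...   | false | _ = ⊥-elim (bad tt)
...   | true | ofʸ x<l = inj₁ (earlier R , l , x , w , m , pre++ R (x ∷ w) , x<l , m∈earlier , m<x)
  where
  m<x : m < x
  m<x = ≤∧≢⇒< (≮⇒≥ (bad ∘ <⇒<ᵇ))
               (λ { refl → Unique⇒∉prefix pre uq (bottom∈ R) })
  m∈earlier : m ∈ earlier R
  m∈earlier with ∈-++⁻ (earlier R) (subst (m ∈_) (pre≡ R) (bottom∈ R))
  ... | inj₁ m∈ = m∈
  ... | inj₂ (here refl) = ⊥-elim (<-asym m<x x<l)

rejected⇒violation : ∀ {s pre} w → Represents s pre → Unique (pre ++ w) → ¬ T (accepts s w) →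
                     Violation (pre ++ w)
rejected⇒violation {s} {pre} [] R _ rej =
  inj₂ (earlier R , last s , [] , pre++ R [] , alone⇒max R (¬T-not⇒T (alone s) rej) , nothing)
rejected⇒violation {s} {pre} (x ∷ w) R uq rej with T? (admits s x)
... | no bad = rejected-at x w R uq bad
... | yes ok = subst Violation (++-assoc pre (x ∷ []) w)
  (rejected⇒violation w (Represents-step x R ok) (subst Unique (sym (++-assoc pre (x ∷ []) w)) uq)
     (λ acc → rej (subst T (sym (accepts-∷ s x w)) (T-∧ .from (ok , acc)))))

inadmissible⇒violation : ∀ π → Unique π → ¬ T (admissible π) → Violation π
inadmissible⇒violation [] _ rej = ⊥-elim (rej tt)
inadmissible⇒violation (p ∷ w) uq rej = rejected⇒violation w (start-Represents p) uq rej

avoidsBoth≡admissible : ∀ {n π} → Perm n π → avoids π p12-3→2 ∧ avoids π p1-1→1 ≡ admissible π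
avoidsBoth≡admissible {π = π} perm with T? (admissible π)
... | yes adm = trans (cong₂ (λ b c → not b ∧ not c) (¬T⇒≡false no-p12) (¬T⇒≡false no-p1)) (sym (T-≡ .to adm))
  where
  no-p12 : ¬ T (contains π p12-3→2)
  no-p12 c with contains-p12⇒ perm c
  ... | u , y , z , v , w , e , z<y , w∈u , w<z =
    <-asym w<z (All.lookup (admissible⇒descent-below u adm e z<y) w∈u)
  no-p1 : ¬ T (contains π p1-1→1)
  no-p1 c with contains-p1⇒ perm c
  ... | u , x , v , e , u<x , next = admissible⇒no-singleton u adm e u<x next
... | no rej = trans (violation-rejects (inadmissible⇒violation π (Perm⇒Unique perm) rej)) (sym (¬T⇒≡false rej))
  where
  violation-rejects : Violation π → avoids π p12-3→2 ∧ avoids π p1-1→1 ≡ false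
  violation-rejects (inj₁ nmd) = cong (λ b → not b ∧ avoids π p1-1→1) (T-≡ .to (contains-p12⇐ perm nmd))
  violation-rejects (inj₂ sb) =
    trans (cong (λ b → avoids π p12-3→2 ∧ not b) (T-≡ .to (contains-p1⇐ perm sb))) (∧-zeroʳ _)

-- Standardisation and the split at 1

count< : ℕ → List ℕ → ℕ
count< y L = ∑ (λ x → [ x <ᵇ y ]) L

rank : List ℕ → ℕ → ℕ
rank L y = suc (count< y L)

std : List ℕ → List ℕ
std L = map (rank L) L

[<ᵇ]-mono : ∀ z {x y} → x ≤ y → [ z <ᵇ x ] ≤ [ z <ᵇ y ]
[<ᵇ]-mono z {x} {y} x≤y with z <ᵇ x | <ᵇ-reflects-< z x | z <ᵇ y | <ᵇ-reflects-< z y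
... | true | ofʸ z<x | false | ofⁿ z≮y = ⊥-elim (z≮y (<-≤-trans z<x x≤y))
... | true | _ | true | _ = ≤-refl
... | false | _ | _ | _ = z≤n

count<-mono : ∀ L {x y} → x ≤ y → count< x L ≤ count< y L
count<-mono [] _ = z≤n
count<-mono (z ∷ L) x≤y = +-mono-≤ ([<ᵇ]-mono z x≤y) (count<-mono L x≤y)

count<-strict : ∀ L {x y} → x < y → x ∈ L → count< x L < count< y L
count<-strict (z ∷ L) {x} {y} x<y (here refl) with x <ᵇ x | <ᵇ-reflects-< x x | x <ᵇ y | <ᵇ-reflects-< x y
... | true | ofʸ x<x | _ | _ = ⊥-elim (<-irrefl refl x<x)
... | false | _ | false | ofⁿ x≮y = ⊥-elim (x≮y x<y)
... | false | _ | true | _ = s≤s (count<-mono L (<⇒≤ x<y))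
count<-strict (z ∷ L) x<y (there x∈L) = +-mono-≤-< ([<ᵇ]-mono z (<⇒≤ x<y)) (count<-strict L x<y x∈L)

rank-<ᵇ : ∀ L {x y} → x ∈ L → (rank L x <ᵇ rank L y) ≡ (x <ᵇ y)
rank-<ᵇ L {x} {y} x∈L with x <ᵇ y | <ᵇ-reflects-< x y
... | true | ofʸ x<y = T-≡ .to (<⇒<ᵇ (s≤s (count<-strict L x<y x∈L)))
... | false | ofⁿ x≮y = ¬T⇒≡false (λ t → <⇒≱ (<ᵇ⇒< _ _ t) (s≤s (count<-mono L (≮⇒≥ x≮y))))

count<-all : ∀ N P → All (_< N) P → count< N P ≡ length P
count<-all N [] [] = refl
count<-all N (p ∷ P) (p<N ∷ P<N) = cong₂ _+_ (cong [_] (T-≡ .to (<⇒<ᵇ p<N))) (count<-all N P P<N)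

map-insertEverywhere : ∀ (g : ℕ → ℕ) x L → map (map g) (insertEverywhere x L) ≡ insertEverywhere (g x) (map g L)
map-insertEverywhere g x [] = refl
map-insertEverywhere g x (y ∷ L) = cong ((g x ∷ g y ∷ map g L) ∷_)
  (trans (sym (map-∘ (insertEverywhere x L)))
         (trans (map-∘ (insertEverywhere x L)) (cong (map (g y ∷_)) (map-insertEverywhere g x L))))

overInsertions : (List ℕ → ℕ) → List ℕ → ℕ
overInsertions F τ = ∑ F (insertEverywhere (suc (length τ)) τ)

∑-insert-std : ∀ (F : List ℕ → ℕ) N P → All (_< N) P →
  ∑ (F ∘ std) (insertEverywhere N P) ≡ overInsertions F (std P)
∑-insert-std F N P P<N = begin
    ∑ (F ∘ std) I
  ≡⟨ ∑-cong (All.map (cong F ∘ std≡) (insertEverywhere-↭ N P)) ⟩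
    ∑ (F ∘ map (rank P)) I
  ≡⟨ sym (∑-map F (map (rank P)) I) ⟩
    ∑ F (map (map (rank P)) I)
  ≡⟨ cong (∑ F) (map-insertEverywhere (rank P) N P) ⟩
    ∑ F (insertEverywhere (rank P N) (std P))
  ≡⟨ cong (λ k → ∑ F (insertEverywhere (suc k) (std P)))
          (trans (count<-all N P P<N) (sym (length-map (rank P) P))) ⟩
    overInsertions F (std P)
  ∎
  where
  open ≡-Reasoning
  I = insertEverywhere N P
  rank-insert : ∀ {P′} → P′ ↭ N ∷ P → ∀ {y} → y ≤ N → rank P′ y ≡ rank P y
  rank-insert p {y} y≤N =
    cong suc (trans (∑-↭ _ p) (cong (λ b → [ b ] + count< y P) (¬T⇒≡false (λ t → <⇒≱ (<ᵇ⇒< N y t) y≤N))))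
  std≡ : ∀ {P′} → P′ ↭ N ∷ P → std P′ ≡ map (rank P) P′
  std≡ p = map-cong-local (All.map (rank-insert p) (All-resp-↭ (↭-sym p) (≤-refl ∷ All.map <⇒≤ P<N)))

splitAt1 : List ℕ → List ℕ × List ℕ
splitAt1 [] = [] , []
splitAt1 (x ∷ xs) = if x ≡ᵇ 1 then ([] , xs) else map₁ (x ∷_) (splitAt1 xs)

splitAt1-++ : ∀ P z → 1 ∉ P → splitAt1 (P ++ 1 ∷ z) ≡ (P , z)
splitAt1-++ [] z _ = refl
splitAt1-++ (p ∷ P) z 1∉ with p ≡ᵇ 1 | ≡ᵇ-reflects-≡ p 1
... | true | ofʸ refl = ⊥-elim (1∉ (here refl))
... | false | _ = cong (map₁ (p ∷_)) (splitAt1-++ P z (1∉ ∘ there))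

increasingFrom : ℕ → List ℕ → Bool
increasingFrom l [] = true
increasingFrom l (x ∷ z) = (l <ᵇ x) ∧ increasingFrom x z

-- Inserting the maximum x keeps the word increasing only when x goes last.
∑-insert-increasing : ∀ l x z → l < x → All (_< x) z →
  ∑ ([_] ∘ increasingFrom l) (insertEverywhere x z) ≡ [ increasingFrom l z ]
∑-insert-increasing l x [] l<x [] rewrite T-≡ .to (<⇒<ᵇ l<x) = refl
∑-insert-increasing l x (y ∷ z) l<x (y<x ∷ z<x)
  rewrite ¬T⇒≡false (λ t → <⇒≱ (<ᵇ⇒< x y t) (<⇒≤ y<x)) | ∧-zeroʳ (l <ᵇ x) =
  trans (∑-map ([_] ∘ increasingFrom l) (y ∷_) (insertEverywhere x z)) (after-y (l <ᵇ y))
  where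
  after-y : ∀ b → ∑ (λ z′ → [ b ∧ increasingFrom y z′ ]) (insertEverywhere x z) ≡ [ b ∧ increasingFrom y z ]
  after-y true = ∑-insert-increasing y x z y<x z<x
  after-y false = ∑-≡0 (All.universal (λ _ → refl) (insertEverywhere x z))

∑-insert-++ : ∀ (g : List ℕ → ℕ) x P y z →
  ∑ g (insertEverywhere x (P ++ y ∷ z))
    ≡ ∑ (λ P′ → g (P′ ++ y ∷ z)) (insertEverywhere x P) + ∑ (λ z′ → g (P ++ y ∷ z′)) (insertEverywhere x z)
∑-insert-++ g x [] y z =
  cong₂ _+_ (sym (+-identityʳ (g (x ∷ y ∷ z)))) (∑-map g (y ∷_) (insertEverywhere x z))
∑-insert-++ g x (p ∷ P) y z = begin
    g (x ∷ p ∷ P ++ y ∷ z) + ∑ g (map (p ∷_) (insertEverywhere x (P ++ y ∷ z)))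
  ≡⟨ cong (g (x ∷ p ∷ P ++ y ∷ z) +_) (∑-map g (p ∷_) (insertEverywhere x (P ++ y ∷ z))) ⟩
    g (x ∷ p ∷ P ++ y ∷ z) + ∑ (g ∘ (p ∷_)) (insertEverywhere x (P ++ y ∷ z))
  ≡⟨ cong (g (x ∷ p ∷ P ++ y ∷ z) +_) (∑-insert-++ (g ∘ (p ∷_)) x P y z) ⟩
    g (x ∷ p ∷ P ++ y ∷ z) + (∑ (λ P′ → g (p ∷ P′ ++ y ∷ z)) (insertEverywhere x P) + Z)
  ≡⟨ sym (+-assoc (g (x ∷ p ∷ P ++ y ∷ z)) _ Z) ⟩
    g (x ∷ p ∷ P ++ y ∷ z) + ∑ (λ P′ → g (p ∷ P′ ++ y ∷ z)) (insertEverywhere x P) + Z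
  ≡⟨ cong (λ t → g (x ∷ p ∷ P ++ y ∷ z) + t + Z)
          (sym (∑-map (λ P′ → g (P′ ++ y ∷ z)) (p ∷_) (insertEverywhere x P))) ⟩
    ∑ (λ P′ → g (P′ ++ y ∷ z)) (insertEverywhere x (p ∷ P)) + Z
  ∎
  where
  open ≡-Reasoning
  Z = ∑ (λ z′ → g (p ∷ P ++ y ∷ z′)) (insertEverywhere x z)

weight : (List ℕ → ℕ) → List ℕ × List ℕ → ℕ
weight F (P , z) = [ increasingFrom 1 z ] * F (std P)

splitWeight : (List ℕ → ℕ) → List ℕ → ℕ
splitWeight F π = weight F (splitAt1 π)

∑-S-overInsertions : ∀ m F → ∑ (overInsertions F) (S m) ≡ ∑ F (S (suc m))
∑-S-overInsertions m F =
  trans (∑-cong (All.map (λ {τ} p → cong (λ k → ∑ F (insertEverywhere (suc k) τ)) (Perm⇒length p)) (S-Perm m)))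
        (sym (∑-concatMap F (insertEverywhere (suc m)) (S m)))

splitAt1-perm : ∀ {n} P z → Perm n (P ++ 1 ∷ z) → splitAt1 (P ++ 1 ∷ z) ≡ (P , z)
splitAt1-perm P z perm = splitAt1-++ P z (Unique⇒∉prefix P (Perm⇒Unique perm))

∑-insert-at-1 : ∀ {n} P z → Perm (suc n) (P ++ 1 ∷ z) → (g : List ℕ × List ℕ → ℕ) →
  ∑ (g ∘ splitAt1) (insertEverywhere (suc (suc n)) (P ++ 1 ∷ z))
    ≡ ∑ (λ P′ → g (P′ , z)) (insertEverywhere (suc (suc n)) P)
      + ∑ (λ z′ → g (P , z′)) (insertEverywhere (suc (suc n)) z)
∑-insert-at-1 {n} P z perm g =
  trans (∑-insert-++ (g ∘ splitAt1) (suc (suc n)) P 1 z)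
        (cong₂ _+_ (∑-cong (All.map (λ {P′} p → cong g (splitAt1-++ P′ z (1∉N∷P ∘ ∈-resp-↭ p)))
                                    (insertEverywhere-↭ (suc (suc n)) P)))
                   (∑-cong (All.universal (λ z′ → cong g (splitAt1-++ P z′ 1∉P))
                                          (insertEverywhere (suc (suc n)) z))))
  where
  1∉P : 1 ∉ P
  1∉P = Unique⇒∉prefix P (Perm⇒Unique perm)
  1∉N∷P : 1 ∉ suc (suc n) ∷ P
  1∉N∷P (there 1∈P) = 1∉P 1∈P

∑-insert-splitWeight : ∀ n F {π} → Perm (suc n) π →
  ∑ (splitWeight F) (insertEverywhere (suc (suc n)) π) ≡ splitWeight (overInsertions F) π + splitWeight F π
∑-insert-splitWeight n F perm with ∈-∃++ (Perm-∋ perm ≤-refl (s≤s z≤n))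
... | P , z , refl = begin
    ∑ (splitWeight F) (insertEverywhere N (P ++ 1 ∷ z))
  ≡⟨ ∑-insert-at-1 P z perm (weight F) ⟩
    ∑ (λ P′ → [ inc z ] * F (std P′)) (insertEverywhere N P)
      + ∑ (λ z′ → [ inc z′ ] * F (std P)) (insertEverywhere N z)
  ≡⟨ cong₂ _+_ (∑-*ˡ [ inc z ] (F ∘ std) (insertEverywhere N P))
               (∑-*ʳ ([_] ∘ inc) (F (std P)) (insertEverywhere N z)) ⟩
    [ inc z ] * ∑ (F ∘ std) (insertEverywhere N P) + ∑ ([_] ∘ inc) (insertEverywhere N z) * F (std P)
  ≡⟨ cong₂ (λ s t → [ inc z ] * s + t * F (std P))
           (∑-insert-std F N P (++⁻ˡ P (Perm⇒below perm)))
           (∑-insert-increasing 1 N z (s≤s (s≤s z≤n)) (All.tail (++⁻ʳ P (Perm⇒below perm)))) ⟩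
    weight (overInsertions F) (P , z) + weight F (P , z)
  ≡⟨ cong (λ Pz → weight (overInsertions F) Pz + weight F Pz) (sym (splitAt1-perm P z perm)) ⟩
    splitWeight (overInsertions F) (P ++ 1 ∷ z) + splitWeight F (P ++ 1 ∷ z)
  ∎
  where
  open ≡-Reasoning
  N = suc (suc n)
  inc = increasingFrom 1

∑-S-splitWeight : ∀ n F → ∑ (splitWeight F) (S (suc n)) ≡ sumBelow (suc n) (λ m → (n C m) * ∑ F (S m))
∑-S-splitWeight zero F = cong (λ t → 1 * t + 0) (sym (+-identityʳ (F [])))
∑-S-splitWeight (suc n) F = begin
    ∑ (splitWeight F) (concatMap (insertEverywhere (suc (suc n))) (S (suc n)))
  ≡⟨ ∑-concatMap (splitWeight F) (insertEverywhere (suc (suc n))) (S (suc n)) ⟩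
    ∑ (λ π → ∑ (splitWeight F) (insertEverywhere (suc (suc n)) π)) (S (suc n))
  ≡⟨ ∑-cong (All.map (∑-insert-splitWeight n F) (S-Perm (suc n))) ⟩
    ∑ (λ π → splitWeight (overInsertions F) π + splitWeight F π) (S (suc n))
  ≡⟨ ∑-+ (splitWeight (overInsertions F)) (splitWeight F) (S (suc n)) ⟩
    ∑ (splitWeight (overInsertions F)) (S (suc n)) + ∑ (splitWeight F) (S (suc n))
  ≡⟨ cong₂ _+_ (∑-S-splitWeight n (overInsertions F)) (∑-S-splitWeight n F) ⟩
    sumBelow (suc n) (λ m → (n C m) * ∑ (overInsertions F) (S m)) + sumBelow (suc n) (λ m → (n C m) * ∑ F (S m))
  ≡⟨ sym (sumBelow-distrib (suc n) (n C_) (λ m → ∑ (overInsertions F) (S m)) (λ m → ∑ F (S m))) ⟩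
    sumBelow (suc n) (λ m → (n C m) * (∑ (overInsertions F) (S m) + ∑ F (S m)))
  ≡⟨ sumBelow-cong (suc n) (λ m → cong (λ t → (n C m) * (t + ∑ F (S m))) (∑-S-overInsertions m F)) ⟩
    sumBelow (suc n) (λ m → (n C m) * (∑ F (S (suc m)) + ∑ F (S m)))
  ≡⟨ sym (sumBelow-pascal n (λ m → ∑ F (S m))) ⟩
    sumBelow (suc (suc n)) (λ m → (suc n C m) * ∑ F (S m))
  ∎
  where open ≡-Reasoning

-- Counting admissible permutations

Fields : (ℕ → Set) → Scan → Set
Fields G s = G (top s) × G (bottom s) × G (last s)

Fields-step : ∀ {G} s x → Fields G s → G x → Fields G (step s x)
Fields-step (scan M m l a) x (gM , gm , gl) gx with M <ᵇ x
... | true = gx , gm , gx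
... | false with x <ᵇ l
...   | true = gM , gx , gx
...   | false = gM , gm , gx

Fields-run : ∀ {G} s w → Fields G s → All G w → Fields G (run s w)
Fields-run s [] gs [] = gs
Fields-run s (x ∷ w) gs (gx ∷ gw) = Fields-run (step s x) w (Fields-step s x gs gx) gw

module _ (f : ℕ → ℕ) {G : ℕ → Set} (mono : ∀ {x y : ℕ} → G x → G y → (f x <ᵇ f y) ≡ (x <ᵇ y)) where

  mapScan : Scan → Scan
  mapScan (scan M m l a) = scan (f M) (f m) (f l) a

  admits-map : ∀ s x → Fields G s → G x → admits (mapScan s) (f x) ≡ admits s x
  admits-map (scan M m l a) x (gM , gm , gl) gx rewrite mono gM gx | mono gx gl | mono gx gm = refl

  step-map : ∀ s x → Fields G s → G x → step (mapScan s) (f x) ≡ mapScan (step s x)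
  step-map (scan M m l a) x (gM , gm , gl) gx rewrite mono gM gx | mono gx gl with M <ᵇ x
  ... | true = refl
  ... | false with x <ᵇ l
  ...   | true = refl
  ...   | false = refl

  admitsAll-map : ∀ s w → Fields G s → All G w → admitsAll (mapScan s) (map f w) ≡ admitsAll s w
  admitsAll-map s [] _ _ = refl
  admitsAll-map s (x ∷ w) gs (gx ∷ gw) rewrite admits-map s x gs gx | step-map s x gs gx =
    cong (admits s x ∧_) (admitsAll-map (step s x) w (Fields-step s x gs gx) gw)

  nearlyAdmissible-map : ∀ w → All G w → nearlyAdmissible (map f w) ≡ nearlyAdmissible w
  nearlyAdmissible-map [] _ = refl
  nearlyAdmissible-map (x ∷ w) (gx ∷ gw) = admitsAll-map (start x) w (gx , gx , gx) gw

nearlyAdmissible-std : ∀ L → nearlyAdmissible (std L) ≡ nearlyAdmissible L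
nearlyAdmissible-std L =
  nearlyAdmissible-map (rank L) (λ {x} {y} x∈L _ → rank-<ᵇ L {x} {y} x∈L) L (All.tabulate (λ x∈L → x∈L))

all-<ᵇ-true : ∀ K z → All (_< K) z → all (_<ᵇ K) z ≡ true
all-<ᵇ-true K [] [] = refl
all-<ᵇ-true K (y ∷ z) (y<K ∷ z<K) rewrite T-≡ .to (<⇒<ᵇ y<K) = all-<ᵇ-true K z z<K

all-<ᵇ-false : ∀ K {x} z → x ∈ z → K ≤ x → all (_<ᵇ K) z ≡ false
all-<ᵇ-false K (y ∷ z) (here refl) K≤y rewrite ¬T⇒≡false (λ t → <⇒≱ (<ᵇ⇒< y K t) K≤y) = refl
all-<ᵇ-false K (y ∷ z) (there x∈z) K≤x rewrite all-<ᵇ-false K z x∈z K≤x = ∧-zeroʳ (y <ᵇ K)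

top-run : ∀ s w → top s ≤ top (run s w) × All (_≤ top (run s w)) w
top-run s [] = ≤-refl , []
top-run s (x ∷ w) with top-run (step s x) w
... | s≤ , w≤ = ≤-trans (step-top s x .proj₁) s≤ , ≤-trans (step-top s x .proj₂) s≤ ∷ w≤
  where
  step-top : ∀ s x → top s ≤ top (step s x) × x ≤ top (step s x)
  step-top (scan M m l a) x with M <ᵇ x | <ᵇ-reflects-< M x
  ... | true | ofʸ M<x = <⇒≤ M<x , ≤-refl
  ... | false | ofⁿ M≮x with x <ᵇ l
  ...   | true = ≤-refl , ≮⇒≥ M≮x
  ...   | false = ≤-refl , ≮⇒≥ M≮x

accepts-after-new-max : ∀ x z → All (1 <_) z → All (x ≢_) z → accepts (scan x 1 x true) z ≡ false
accepts-after-new-max x [] _ _ = refl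
accepts-after-new-max x (y ∷ w) (1<y ∷ _) (x≢y ∷ _) with x <ᵇ y | <ᵇ-reflects-< x y
... | true | _ = refl
... | false | ofⁿ x≮y with y <ᵇ x | <ᵇ-reflects-< y x
...   | true | _ rewrite ¬T⇒≡false (λ t → <-asym (<ᵇ⇒< y 1 t) 1<y) = refl
...   | false | ofⁿ y≮x = ⊥-elim (x≢y (≤-antisym (≮⇒≥ y≮x) (≮⇒≥ x≮y)))

accepts-after-1 : ∀ M l z → All (λ x → 1 < x × x ≢ M) z → Unique (l ∷ z) →
  accepts (scan M 1 l false) z ≡ increasingFrom l z ∧ all (_<ᵇ M) z
accepts-after-1 M l [] _ _ = refl
accepts-after-1 M l (x ∷ z) ((1<x , x≢M) ∷ z-ok) ((l≢x ∷ _) ∷ x∉ ∷ uq) with M <ᵇ x | <ᵇ-reflects-< M x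
... | true | ofʸ M<x rewrite ¬T⇒≡false (λ t → <-asym (<ᵇ⇒< x M t) M<x) =
  trans (accepts-after-new-max x z (All.map proj₁ z-ok) x∉) (sym (∧-zeroʳ _))
... | false | ofⁿ M≮x with x <ᵇ l | <ᵇ-reflects-< x l
...   | true | ofʸ x<l
  rewrite ¬T⇒≡false (λ t → <-asym (<ᵇ⇒< x 1 t) 1<x) | ¬T⇒≡false (λ t → <-asym (<ᵇ⇒< l x t) x<l) = refl
...   | false | ofⁿ x≮l
  rewrite T-≡ .to (<⇒<ᵇ (≤∧≢⇒< (≮⇒≥ x≮l) l≢x)) | T-≡ .to (<⇒<ᵇ (≤∧≢⇒< (≮⇒≥ M≮x) x≢M)) =
  accepts-after-1 M x z z-ok (x∉ ∷ uq)

accepts-from-1 : ∀ s z → Fields (1 <_) s → All (λ x → 1 < x × x ≢ top s) z → Unique (1 ∷ z) →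
  accepts s (1 ∷ z) ≡ increasingFrom 1 z ∧ all (_<ᵇ top s) z
accepts-from-1 (scan M m l a) z (1<M , 1<m , 1<l) z-ok uq
  rewrite ¬T⇒≡false (λ t → <-asym (<ᵇ⇒< M 1 t) 1<M) | T-≡ .to (<⇒<ᵇ 1<l) | T-≡ .to (<⇒<ᵇ 1<m) =
  accepts-after-1 M 1 z z-ok uq

top-run-start : ∀ p P₁ → top (run (start p) P₁) ∈ p ∷ P₁ × All (_≤ top (run (start p) P₁)) (p ∷ P₁)
top-run-start p P₁ with top-run (start p) P₁
... | p≤ , P₁≤ = proj₁ (Fields-run (start p) P₁ (here refl , here refl , here refl) (All.tabulate there)) , p≤ ∷ P₁≤

admissible-++-1 : ∀ p P₁ z → All (1 <_) (p ∷ P₁) → All (1 <_) z → Unique (p ∷ P₁ ++ 1 ∷ z) →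
  admissible (p ∷ P₁ ++ 1 ∷ z)
    ≡ nearlyAdmissible (p ∷ P₁) ∧ (increasingFrom 1 z ∧ all (_<ᵇ top (run (start p) P₁)) z)
admissible-++-1 p P₁ z (1<p ∷ 1<P₁) 1<z uq =
  trans (accepts-++ (start p) P₁ (1 ∷ z))
        (cong (admitsAll (start p) P₁ ∧_)
              (accepts-from-1 s z (Fields-run (start p) P₁ (1<p , 1<p , 1<p) 1<P₁) z-ok (Unique-++ʳ (p ∷ P₁) uq)))
  where
  s = run (start p) P₁
  z-ok : All (λ x → 1 < x × x ≢ top s) z
  z-ok = All.tabulate λ x∈z →
    All.lookup 1<z x∈z , λ { refl → Unique⇒disjoint (p ∷ P₁) uq (proj₁ (top-run-start p P₁)) (there x∈z) }

module _ {N : ℕ} (P z : List ℕ) (perm : Perm N (P ++ 1 ∷ z)) where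

  private
    above-1 : ∀ {x} → x ∈ P ++ 1 ∷ z → 1 ≢ x → 1 < x
    above-1 x∈ 1≢x = ≤∧≢⇒< (proj₁ (All.lookup (Perm⇒bounded perm) x∈)) 1≢x

  split-above-1 : All (1 <_) P × All (1 <_) z
  split-above-1 with Unique-++ʳ P (Perm⇒Unique perm)
  ... | 1∉z ∷ _ =
    All.tabulate (λ x∈P → above-1 (∈-++⁺ˡ x∈P) (λ { refl → Unique⇒∉prefix P (Perm⇒Unique perm) x∈P })) ,
    All.tabulate (λ x∈z → above-1 (∈-++⁺ʳ P (there x∈z)) (All.lookup 1∉z x∈z))

  split-≤N : ∀ {x} → x ∈ P → x ≤ N
  split-≤N x∈P = proj₂ (All.lookup (Perm⇒bounded perm) (∈-++⁺ˡ x∈P))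

  split-∋N : 2 ≤ N → N ∈ P ⊎ N ∈ z
  split-∋N 2≤N with ∈-++⁻ P (Perm-∋ perm (≤-trans (s≤s z≤n) 2≤N) ≤-refl)
  ... | inj₁ N∈P = inj₁ N∈P
  ... | inj₂ (here refl) = ⊥-elim (<⇒≱ 2≤N ≤-refl)
  ... | inj₂ (there N∈z) = inj₂ N∈z

splitAdmissible : ℕ → List ℕ × List ℕ → Bool
splitAdmissible N (P , z) = nearlyAdmissible P ∧ (increasingFrom 1 z ∧ all (_<ᵇ N) z)

splitAdmissible-below : ∀ {N} P′ {z} → All (_< N) z →
  [ splitAdmissible N (P′ , z) ] ≡ [ increasingFrom 1 z ] * [ nearlyAdmissible (std P′) ]
splitAdmissible-below {N} P′ {z} z<N
  rewrite all-<ᵇ-true N z z<N | ∧-identityʳ (increasingFrom 1 z) | nearlyAdmissible-std P′ =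
  [∧]≡* (nearlyAdmissible P′) (increasingFrom 1 z)

splitAdmissible-∋N : ∀ {N} P {z} → N ∈ z → splitAdmissible N (P , z) ≡ false
splitAdmissible-∋N {N} P {z} N∈z rewrite all-<ᵇ-false N z N∈z ≤-refl | ∧-zeroʳ (increasingFrom 1 z) =
  ∧-zeroʳ (nearlyAdmissible P)

admissible-at-1 : ∀ {N} P z → 2 ≤ N → Perm N (P ++ 1 ∷ z) →
                  admissible (P ++ 1 ∷ z) ≡ splitAdmissible N (P , z)
admissible-at-1 {N} [] z 2≤N perm with split-∋N [] z perm 2≤N | Perm⇒Unique perm
... | inj₂ N∈z | 1∉z ∷ _ =
  trans (accepts-after-new-max 1 z (proj₂ (split-above-1 [] z perm)) 1∉z)
        (sym (splitAdmissible-∋N [] N∈z))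
admissible-at-1 {N} (p ∷ P₁) z 2≤N perm =
  trans (admissible-++-1 p P₁ z 1<P 1<z (Perm⇒Unique perm))
        (cong (λ b → nearlyAdmissible (p ∷ P₁) ∧ (increasingFrom 1 z ∧ b)) (top-is-N (split-∋N (p ∷ P₁) z perm 2≤N)))
  where
  1<P = proj₁ (split-above-1 (p ∷ P₁) z perm)
  1<z = proj₂ (split-above-1 (p ∷ P₁) z perm)
  M = top (run (start p) P₁)
  M≤N : M ≤ N
  M≤N = split-≤N (p ∷ P₁) z perm (proj₁ (top-run-start p P₁))
  top-is-N : N ∈ p ∷ P₁ ⊎ N ∈ z → all (_<ᵇ M) z ≡ all (_<ᵇ N) z
  top-is-N (inj₁ N∈P) = cong (λ K → all (_<ᵇ K) z) (≤-antisym M≤N (All.lookup (proj₂ (top-run-start p P₁)) N∈P))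
  top-is-N (inj₂ N∈z) = trans (all-<ᵇ-false M z N∈z M≤N) (sym (all-<ᵇ-false N z N∈z ≤-refl))

admissible-split : ∀ {N π} → 2 ≤ N → Perm N π → admissible π ≡ splitAdmissible N (splitAt1 π)
admissible-split 2≤N perm with ∈-∃++ (Perm-∋ perm ≤-refl (≤-trans (s≤s z≤n) 2≤N))
... | P , z , refl rewrite splitAt1-perm P z perm = admissible-at-1 P z 2≤N perm

∑-insert-admissible : ∀ k {π} → Perm (suc k) π →
  ∑ ([_] ∘ admissible) (insertEverywhere (suc (suc k)) π)
    ≡ splitWeight (overInsertions ([_] ∘ nearlyAdmissible)) π
∑-insert-admissible k perm with ∈-∃++ (Perm-∋ perm ≤-refl (s≤s z≤n))
... | P , z , refl = begin
    ∑ ([_] ∘ admissible) (insertEverywhere N (P ++ 1 ∷ z))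
  ≡⟨ ∑-cong (All.map (cong [_] ∘ admissible-split (s≤s (s≤s z≤n))) (Perm-insert perm)) ⟩
    ∑ ([_] ∘ splitAdmissible N ∘ splitAt1) (insertEverywhere N (P ++ 1 ∷ z))
  ≡⟨ ∑-insert-at-1 P z perm ([_] ∘ splitAdmissible N) ⟩
    ∑ (λ P′ → [ splitAdmissible N (P′ , z) ]) (insertEverywhere N P)
      + ∑ (λ z′ → [ splitAdmissible N (P , z′) ]) (insertEverywhere N z)
  ≡⟨ cong₂ _+_ (∑-cong (All.universal (λ P′ → splitAdmissible-below P′ z<N) (insertEverywhere N P)))
               (∑-≡0 (All.map (λ p → cong [_] (splitAdmissible-∋N P (∈-resp-↭ (↭-sym p) (here refl))))
                              (insertEverywhere-↭ N z))) ⟩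
    ∑ (λ P′ → [ increasingFrom 1 z ] * [ nearlyAdmissible (std P′) ]) (insertEverywhere N P) + 0
  ≡⟨ trans (+-identityʳ _) (∑-*ˡ [ increasingFrom 1 z ] ([_] ∘ nearlyAdmissible ∘ std) (insertEverywhere N P)) ⟩
    [ increasingFrom 1 z ] * ∑ ([_] ∘ nearlyAdmissible ∘ std) (insertEverywhere N P)
  ≡⟨ cong ([ increasingFrom 1 z ] *_) (∑-insert-std ([_] ∘ nearlyAdmissible) N P (++⁻ˡ P (Perm⇒below perm))) ⟩
    weight (overInsertions ([_] ∘ nearlyAdmissible)) (P , z)
  ≡⟨ cong (weight (overInsertions ([_] ∘ nearlyAdmissible))) (sym (splitAt1-perm P z perm)) ⟩
    splitWeight (overInsertions ([_] ∘ nearlyAdmissible)) (P ++ 1 ∷ z)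
  ∎
  where
  open ≡-Reasoning
  N = suc (suc k)
  z<N : All (_< N) z
  z<N = All.tail (++⁻ʳ P (Perm⇒below perm))

step-below-top : ∀ s x → x < top s → top (step s x) ≡ top s × alone (step s x) ≡ false
step-below-top (scan M m l a) x x<M rewrite ¬T⇒≡false (λ t → <-asym (<ᵇ⇒< M x t) x<M) with x <ᵇ l
... | true = refl , refl
... | false = refl , refl

run-below-top : ∀ s x w → All (_< top s) (x ∷ w) → alone (run s (x ∷ w)) ≡ false
run-below-top s x [] (x<M ∷ []) = proj₂ (step-below-top s x x<M)
run-below-top s x (y ∷ w) (x<M ∷ w<M) =
  run-below-top (step s x) y w (subst (λ K → All (_< K) (y ∷ w)) (sym (proj₁ (step-below-top s x x<M))) w<M)

step-top-below : ∀ s x {N} → top s < N → x < N → top (step s x) < N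
step-top-below (scan M m l a) x M<N x<N with M <ᵇ x
... | true = x<N
... | false with x <ᵇ l
...   | true = M<N
...   | false = M<N

step-new-top : ∀ s {N} → top s < N → top (step s N) ≡ N
step-new-top (scan M m l a) M<N rewrite T-≡ .to (<⇒<ᵇ M<N) = refl

-- A run that ends alone after inserting the maximum N must have put N last.
∑-insert-alone : ∀ s N τ → top s < N → All (_< N) τ →
  ∑ (λ τ′ → [ admitsAll s τ′ ∧ alone (run s τ′) ]) (insertEverywhere N τ) ≡ [ accepts s τ ]
∑-insert-alone (scan M m l a) N [] M<N [] rewrite T-≡ .to (<⇒<ᵇ M<N) with a
... | true = refl
... | false = refl
∑-insert-alone s N (x ∷ τ) M<N (x<N ∷ τ<N) =
  trans (cong₂ _+_ N-first (∑-map (λ τ′ → [ admitsAll s τ′ ∧ alone (run s τ′) ]) (x ∷_) (insertEverywhere N τ)))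
        (after-x (admits s x))
  where
  N-first : [ admitsAll s (N ∷ x ∷ τ) ∧ alone (run s (N ∷ x ∷ τ)) ] ≡ 0
  N-first
    rewrite run-below-top (step s N) x τ (subst (λ K → All (_< K) (x ∷ τ)) (sym (step-new-top s M<N)) (x<N ∷ τ<N))
          | ∧-zeroʳ (admitsAll s (N ∷ x ∷ τ)) = refl
  after-x : ∀ b →
    0 + ∑ (λ τ′ → [ (b ∧ admitsAll (step s x) τ′) ∧ alone (run (step s x) τ′) ]) (insertEverywhere N τ)
      ≡ [ (b ∧ admitsAll (step s x) τ) ∧ not (alone (run (step s x) τ)) ]
  after-x true = ∑-insert-alone (step s x) N τ (step-top-below s x M<N x<N) τ<N
  after-x false = ∑-≡0 (All.universal (λ _ → refl) (insertEverywhere N τ))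

∑-insert-endsAlone : ∀ N τ → All (_< N) τ →
  ∑ (λ τ′ → [ nearlyAdmissible τ′ ∧ endsAlone τ′ ]) (insertEverywhere N τ) ≡ [ admissible τ ]
∑-insert-endsAlone N [] [] = refl
∑-insert-endsAlone N (x ∷ τ) (x<N ∷ τ<N) =
  trans (cong₂ _+_ N-first (∑-map (λ τ′ → [ nearlyAdmissible τ′ ∧ endsAlone τ′ ]) (x ∷_) (insertEverywhere N τ)))
        (∑-insert-alone (start x) N τ x<N τ<N)
  where
  N-first : [ nearlyAdmissible (N ∷ x ∷ τ) ∧ endsAlone (N ∷ x ∷ τ) ] ≡ 0
  N-first rewrite run-below-top (start N) x τ (x<N ∷ τ<N) | ∧-zeroʳ (nearlyAdmissible (N ∷ x ∷ τ)) = refl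

[nearly]≡[admissible]+[endsAlone] : ∀ w →
  [ nearlyAdmissible w ] ≡ [ admissible w ] + [ nearlyAdmissible w ∧ endsAlone w ]
[nearly]≡[admissible]+[endsAlone] w with nearlyAdmissible w | endsAlone w
... | true | true = refl
... | true | false = refl
... | false | _ = refl

a≡∑admissible : ∀ n → a n ≡ ∑ ([_] ∘ admissible) (S n)
a≡∑admissible n =
  trans (length-filter≡∑ (λ π → avoids π p12-3→2 ∧ avoids π p1-1→1) (S n))
        (∑-cong (All.map (cong [_] ∘ avoidsBoth≡admissible) (S-Perm n)))

∑-S-nearlyAdmissible : ∀ m → ∑ ([_] ∘ nearlyAdmissible) (S (suc m)) ≡ a (suc m) + a m
∑-S-nearlyAdmissible m = begin
    ∑ ([_] ∘ nearlyAdmissible) (S (suc m))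
  ≡⟨ ∑-cong (All.universal [nearly]≡[admissible]+[endsAlone] (S (suc m))) ⟩
    ∑ (λ w → [ admissible w ] + [ nearlyAdmissible w ∧ endsAlone w ]) (S (suc m))
  ≡⟨ ∑-+ ([_] ∘ admissible) (λ w → [ nearlyAdmissible w ∧ endsAlone w ]) (S (suc m)) ⟩
    ∑ ([_] ∘ admissible) (S (suc m)) + ∑ (λ w → [ nearlyAdmissible w ∧ endsAlone w ]) (S (suc m))
  ≡⟨ cong₂ _+_ (sym (a≡∑admissible (suc m)))
               (∑-concatMap (λ w → [ nearlyAdmissible w ∧ endsAlone w ]) (insertEverywhere (suc m)) (S m)) ⟩
    a (suc m) + ∑ (λ τ → ∑ (λ w → [ nearlyAdmissible w ∧ endsAlone w ]) (insertEverywhere (suc m) τ)) (S m)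
  ≡⟨ cong (a (suc m) +_) (∑-cong (All.map (λ p → ∑-insert-endsAlone (suc m) _ (Perm⇒below p))
                                          (S-Perm m))) ⟩
    a (suc m) + ∑ ([_] ∘ admissible) (S m)
  ≡⟨ cong (a (suc m) +_) (sym (a≡∑admissible m)) ⟩
    a (suc m) + a m
  ∎
  where open ≡-Reasoning

a-recurrence : ∀ k → a (suc (suc k)) ≡ sumBelow (suc k) (λ m → (k C m) * (a (suc m) + a m))
a-recurrence k = begin
    a (suc (suc k))
  ≡⟨ a≡∑admissible (suc (suc k)) ⟩
    ∑ ([_] ∘ admissible) (concatMap (insertEverywhere (suc (suc k))) (S (suc k)))
  ≡⟨ ∑-concatMap ([_] ∘ admissible) (insertEverywhere (suc (suc k))) (S (suc k)) ⟩
    ∑ (λ π → ∑ ([_] ∘ admissible) (insertEverywhere (suc (suc k)) π)) (S (suc k))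
  ≡⟨ ∑-cong (All.map (∑-insert-admissible k) (S-Perm (suc k))) ⟩
    ∑ (splitWeight (overInsertions ([_] ∘ nearlyAdmissible))) (S (suc k))
  ≡⟨ ∑-S-splitWeight k (overInsertions ([_] ∘ nearlyAdmissible)) ⟩
    sumBelow (suc k) (λ m → (k C m) * ∑ (overInsertions ([_] ∘ nearlyAdmissible)) (S m))
  ≡⟨ sumBelow-cong (suc k) (λ m → cong ((k C m) *_)
       (trans (∑-S-overInsertions m ([_] ∘ nearlyAdmissible)) (∑-S-nearlyAdmissible m))) ⟩
    sumBelow (suc k) (λ m → (k C m) * (a (suc m) + a m))
  ∎
  where open ≡-Reasoning

theorem6p7 : (n : ℕ) → 2 ≤ n →
    (a n ≡ sumFromTo 2 n (λ k → ((n ∸ 2) C (k ∸ 2)) * (a (k ∸ 1) + a (k ∸ 2))))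
    × (a n ≡ sumFromTo 0 (n ∸ 1) (λ k → ((n ∸ 1) C k) * a k))
theorem6p7 (suc (suc k)) _ = a-recurrence k , trans (a-recurrence k) (sym (sumBelow-pascal k a))
theorem6p7 1 (s≤s ())
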